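{- Let $I\subseteq[n-1]\setminus\{1\}$ be admissible (no two consecutive integers) and let $J=\{j_1,\ldots,j_r\}\subseteq I$. Then $\Psi_J=\Psi_{j_1}\circ\cdots\circ\Psi_{j_r}$ induces a bijection between the set of $\sigma\in D(S_I,n)$ that admit a $j$-flip for every $j\in J$ and the set $D(S_{I\setminus J},n)$. Moreover, for any $m\ge\max(I)$, any integer $k$, and any such $\sigma$, \[ \{\sigma_1,\ldots,\sigma_m\}\cap[m+1,2m]=[m+1,m+k]\iff \{\Psi_J(\sigma)_1,\ldots,\Psi_J(\sigma)_m\}\cap[m+1,2m]=[m+1,m+k]. \]
   Context: $\mathfrak{S}_n$ is the set of permutations $\sigma=\sigma_1\cdots\sigma_n$ of $[n]=\{1,\ldots,n\}$; $[a,b]=\{a,\ldots,b\}$. $\mathrm{Des}(\sigma)=\{k\in[n-1]:\sigma_k>\sigma_{k+1}\}$ and $D(S,n)$ is the set of $\sigma\in\mathfrak{S}_n$ with $\mathrm{Des}(\sigma)=S$. For $S\subseteq[n-1]$: $\mathrm{Peak}(S)=\{k:1<k\le n-1,\ k\in S,\ k-1\notin S\}$, $\mathrm{Valley}(S)=\{k:1<k\le n-1,\ k\notin S,\ k-1\in S\}$, $\mathrm{Spike}(S)=\mathrm{Peak}(S)\cup\mathrm{Valley}(S)$, $\mathrm{Spike}(\sigma)=\mathrm{Spike}(\mathrm{Des}(\sigma))$. For an admissible set $K=\{k_1<\cdots<k_s\}$, $S_K$ is the unique set $S$ with $\mathrm{Spike}(S)=K$ in which the elements of $K$ alternate between peaks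 and valleys, the largest $k_s$ is a valley, and $S$ has no elements $\ge k_s$; explicitly, with $k_0:=1$, $S_K=\bigcup_{t\text{ odd},\,1\le t\le s}[k_{s-t},\,k_{s-t+1}-1]$ (so $S_\varnothing=\varnothing$). For $i\le n$, write $\{\sigma_1,\ldots,\sigma_i\}=\{a_1<\cdots<a_i\}$ and define $\mathrm{fl}_i(\sigma)$ by $\mathrm{fl}_i(\sigma)_l=a_{i-t+1}$ if $l\le i$ and $\sigma_l=a_t$, and $\mathrm{fl}_i(\sigma)_l=\sigma_l$ for $l>i$. For $i\in\mathrm{Spike}(\sigma)$: $\sigma$ admits an $i^+$-flip if $\mathrm{Spike}(\mathrm{fl}_i(\sigma))=\mathrm{Spike}(\sigma)\setminus\{i\}$, an $i^-$-flip if $\mathrm{Spike}(\mathrm{fl}_{i-1}(\sigma))=\mathrm{Spike}(\sigma)\setminus\{i\}$, and an $i$-flip if either holds. For $\sigma$ admitting an $i$-flip, $\Psi_i(\sigma)=\mathrm{fl}_i(\sigma)$ if $\sigma$ admits an $i^+$-flip and $\Psi_i(\sigma)=\mathrm{fl}_{i-1}(\sigma)$ otherwise. For an admissible $J=\{j_1,\ldots,j_r\}$, $\Psi_J=\Psi_{j_1}\circ\cdots\circ\Psi_{j_r}$ (applied to permutations admitting a $j$-flip for every $j\in J$; the order of composition does not matter). -}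

module Defs where

open import Data.Bool using (Bool; true; false; _∧_; not; if_then_else_; T)
open import Data.Nat using (ℕ; zero; suc; _+_; _∸_; _≤_; _<_; _≤ᵇ_; _<ᵇ_; _≡ᵇ_; _⊔_; _≟_)
open import Data.Nat.Properties using (≤-decTotalOrder)
open import Data.List using (List; []; _∷_; map; filterᵇ; take; drop; _++_; length; foldr; reverse; upTo)
open import Data.Bool.ListAction using (any)
open import Data.List.Properties using (≡-dec)
open import Data.List.Relation.Unary.Linked using (Linked)
open import Data.List.Relation.Unary.All using (All)
open import Data.List.Relation.Binary.Permutation.Propositional using (_↭_)
open import Data.List.Sort.InsertionSort ≤-decTotalOrder using (sort)
open import Data.Integer using (ℤ)
import Data.Integer as Z
open import Data.Product using (_×_)
open import Relation.Nullary.Decidable using (⌊_⌋)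
open import Relation.Binary.PropositionalEquality using (_≡_)

-- 1-indexed entry σ_k of a word (0 if out of range)
at : List ℕ → ℕ → ℕ
at [] _ = 0
at (x ∷ xs) zero = 0
at (x ∷ xs) (suc zero) = x
at (x ∷ xs) (suc (suc k)) = at xs (suc k)

range : ℕ → ℕ → List ℕ
range a b = map (a +_) (upTo (suc b ∸ a))

_∈ᵇ_ : ℕ → List ℕ → Bool
x ∈ᵇ xs = any (x ≡ᵇ_) xs

IsPerm : ℕ → List ℕ → Set
IsPerm n σ = σ ↭ range 1 n

Des : List ℕ → ℕ → Bool
Des σ k = (1 ≤ᵇ k) ∧ (k <ᵇ length σ) ∧ (at σ (suc k) <ᵇ at σ k)

InD : (ℕ → Bool) → ℕ → List ℕ → Set
InD S n σ = IsPerm n σ × (∀ k → Des σ k ≡ S k)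

isSpike : (ℕ → Bool) → ℕ → ℕ → Bool
isSpike S n k = (2 ≤ᵇ k) ∧ (k ≤ᵇ n ∸ 1) ∧
  ((S k ∧ not (S (k ∸ 1))) ∨ᵇ (not (S k) ∧ S (k ∸ 1)))
  where
  _∨ᵇ_ : Bool → Bool → Bool
  true ∨ᵇ _ = true
  false ∨ᵇ b = b

Spike : (ℕ → Bool) → ℕ → List ℕ
Spike S n = filterᵇ (isSpike S n) (range 2 (n ∸ 1))

SpikeP : List ℕ → List ℕ
SpikeP σ = Spike (Des σ) (length σ)

-- S_K for K = k_1 < … < k_s (given as increasing list):
-- with k_0 = 1, S_K = ⋃_{t odd} [k_{s-t}, k_{s-t+1} - 1].
-- Using r = (k_s, k_{s-1}, …, k_0), S_K = [r_1, r_0 - 1] ∪ [r_3, r_2 - 1] ∪ …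
SKrev : List ℕ → ℕ → Bool
SKrev (a ∷ b ∷ rest) x = ((b ≤ᵇ x) ∧ (x <ᵇ a)) ∨' SKrev rest x
  where
  _∨'_ : Bool → Bool → Bool
  true ∨' _ = true
  false ∨' c = c
SKrev _ x = false

S_ : List ℕ → ℕ → Bool
S_ K = SKrev (reverse (1 ∷ K))

Admissible : List ℕ → Set
Admissible K = Linked (λ a b → suc a < b) K

posOf : ℕ → List ℕ → ℕ
posOf x [] = 0
posOf x (y ∷ ys) = if x ≡ᵇ y then 1 else suc (posOf x ys)

fl : ℕ → List ℕ → List ℕ
fl i σ = map f (take i σ) ++ drop i σ
  where
  a : List ℕ
  a = sort (take i σ)          -- a_1 < … < a_i
  f : ℕ → ℕ
  f x = at a (suc (i ∸ posOf x a))   -- a_t ↦ a_{i-t+1}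

remove : ℕ → List ℕ → List ℕ
remove i = filterᵇ (λ k → not (k ≡ᵇ i))

spikeEq : List ℕ → List ℕ → Bool
spikeEq xs ys = ⌊ ≡-dec _≟_ xs ys ⌋

admitsPlus : ℕ → List ℕ → Bool
admitsPlus i σ = (i ∈ᵇ SpikeP σ) ∧ spikeEq (SpikeP (fl i σ)) (remove i (SpikeP σ))

admitsMinus : ℕ → List ℕ → Bool
admitsMinus i σ = (i ∈ᵇ SpikeP σ) ∧ spikeEq (SpikeP (fl (i ∸ 1) σ)) (remove i (SpikeP σ))

AdmitsFlip : ℕ → List ℕ → Set
AdmitsFlip i σ = T (admitsPlus i σ) ⊎' T (admitsMinus i σ)
  where
  open import Data.Sum using () renaming (_⊎_ to _⊎'_)

Ψ : ℕ → List ℕ → List ℕ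
Ψ i σ = if admitsPlus i σ then fl i σ else fl (i ∸ 1) σ

ΨJ : List ℕ → List ℕ → List ℕ
ΨJ [] σ = σ
ΨJ (j ∷ js) σ = Ψ j (ΨJ js σ)

_∖_ : List ℕ → List ℕ → List ℕ
I ∖ J = filterᵇ (λ k → not (k ∈ᵇ J)) I

maxL : List ℕ → ℕ
maxL = foldr _⊔_ 0

inPrefixWindow : ℕ → List ℕ → ℕ → Bool
inPrefixWindow m σ x = (x ∈ᵇ take m σ) ∧ (suc m ≤ᵇ x) ∧ (x ≤ᵇ m + m)

-- x ∈ [m+1, m+k] for an integer k (empty if k ≤ 0)
inIntervalZ : ℕ → ℤ → ℕ → Bool
inIntervalZ m k x = (suc m ≤ᵇ x) ∧ ⌊ (Z.+ x) Z.≤? ((Z.+ m) Z.+ k) ⌋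

Dom : ℕ → List ℕ → List ℕ → List ℕ → Set
Dom n I J σ = InD (S_ I) n σ × All (λ j → AdmitsFlip j σ) J

WindowIs : ℕ → ℤ → List ℕ → Set
WindowIs m k σ = ∀ x → inPrefixWindow m σ x ≡ inIntervalZ m k x

-- For a word σ with distinct entries, fl L σ replaces the rank r of each of the first L entries
-- among themselves by L − 1 − r. It is an involution and a permutation of the first L entries,
-- it negates every descent below L, keeps every descent above L, and only the descent at L
-- itself can go either way. Hence a successful i-flip toggles exactly the descents below i. For
-- admissible K with elements ≥ 2, k ∈ S_K iff k ≥ 1 and an odd number of elements of K exceed k,
-- so toggling below j ∈ K turns S_K into S_{K∖{j}}: each Ψ_j maps D(S_K) into D(S_{K∖{j}}).
-- It is injective because fl is an involution and whether the j⁺-flip succeeds is not affected by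
-- the (j−1)-flip, and surjective because at a non-spike j, if the j⁺-flip breaks the descent at j
-- then the (j−1)-flip breaks the descent at j − 1. A flip at L > j + 1 complements the first
-- j + 1 entries and so does not change which j-flips succeed; induction on J gives the bijection.
-- All flips act within the first max I ≤ m positions, so they permute {σ₁, …, σₘ}.

module Submission where

open import Defs
open import Data.Bool using (Bool; true; false; not; _∧_; _∨_; T; if_then_else_; _xor_)
import Data.Bool as Bool
open import Data.Bool.Properties
  using ( not-involutive; ¬-not; ∨-zeroʳ; ∧-zeroʳ; ∧-identityʳ
        ; xor-assoc; xor-comm; xor-identityʳ; xor-inverseˡ; xor-inverseʳ; xor-same)
open import Data.Empty using (⊥-elim)
open import Data.Integer using (ℤ)
open import Data.List using (List; []; _∷_; [_]; map; take; drop; _++_; length; filterᵇ; upTo; reverse)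
open import Data.List.Properties
  using ( length-++; length-map; length-take; length-drop; length-upTo
        ; take++drop≡id; map-∘; map-id-local; unfold-reverse; ≡-dec)
open import Data.List.Membership.Propositional using (_∈_; _∉_)
open import Data.List.Membership.Propositional.Properties using (∈-∃++; ∈-map⁺; ∈-upTo⁺; ∈-filter⁺)
open import Data.List.Relation.Unary.Any using (Any; here; there)
import Data.List.Relation.Unary.Any.Properties as Any
open import Data.List.Relation.Unary.All using (All; []; _∷_)
import Data.List.Relation.Unary.All as All
import Data.List.Relation.Unary.All.Properties as All
open import Data.List.Relation.Unary.AllPairs using (AllPairs; []; _∷_)
import Data.List.Relation.Unary.AllPairs as AllPairs
import Data.List.Relation.Unary.AllPairs.Properties as AllPairs
import Data.List.Relation.Unary.Linked.Properties as Linked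
open import Data.List.Relation.Unary.Unique.Propositional using (Unique)
import Data.List.Relation.Unary.Unique.Propositional.Properties as Unique
open import Data.List.Relation.Binary.Permutation.Propositional
  using (_↭_; prep; swap; ↭-sym; ↭⇒↭ₛ) renaming (refl to ↭-refl; trans to ↭-trans)
open import Data.List.Relation.Binary.Permutation.Propositional.Properties
  using (All-resp-↭; ∈-resp-↭; ↭-length; shift; ++⁺ʳ; ↭-reverse)
import Data.List.Relation.Binary.Permutation.Setoid.Properties as Permₛ
open import Data.List.Relation.Binary.Sublist.Propositional using (_⊆_; []; _∷_; _∷ʳ_)
open import Data.List.Relation.Binary.Sublist.Propositional.Properties using (All-resp-⊆; Any-resp-⊆; ∷ˡ⁻)
open import Data.Nat using (ℕ; zero; suc; _+_; _∸_; _≤_; _<_; _≤ᵇ_; _<ᵇ_; _≡ᵇ_; z≤n; s≤s; _≟_)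
open import Data.Nat.Properties
open import Data.List.Sort.InsertionSort ≤-decTotalOrder using (sort)
open import Data.List.Sort.InsertionSort.Properties ≤-decTotalOrder using (sort-↭; sort-↗)
open import Data.Product using (_×_; _,_; proj₁; proj₂; ∃)
open import Data.Sum using (_⊎_; inj₁; inj₂)
import Data.Sum as Sum
open import Data.Unit using (tt)
open import Function using (_∘_)
open import Function.Bundles using (_⇔_; mk⇔; Equivalence)
open import Relation.Binary.Definitions using (tri<; tri≈; tri>)
open import Relation.Binary.PropositionalEquality
  using (_≡_; _≢_; refl; sym; trans; cong; cong₂; subst; subst₂; setoid; module ≡-Reasoning)
open import Relation.Nullary using (¬_; yes; no)
open import Relation.Nullary.Decidable using (T?)
open import Relation.Nullary.Reflects using (ofʸ; ofⁿ)

<ᵇ-cases : ∀ x y → (x < y × (x <ᵇ y) ≡ true) ⊎ (y ≤ x × (x <ᵇ y) ≡ false)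
<ᵇ-cases x y with x <ᵇ y | <ᵇ-reflects-< x y
... | true  | ofʸ x<y = inj₁ (x<y , refl)
... | false | ofⁿ x≮y = inj₂ (≮⇒≥ x≮y , refl)

≤ᵇ-cases : ∀ x y → (x ≤ y × (x ≤ᵇ y) ≡ true) ⊎ (y < x × (x ≤ᵇ y) ≡ false)
≤ᵇ-cases x y with x ≤ᵇ y | ≤ᵇ-reflects-≤ x y
... | true  | ofʸ x≤y = inj₁ (x≤y , refl)
... | false | ofⁿ x≰y = inj₂ (≰⇒> x≰y , refl)

<ᵇ-true : ∀ {x y} → x < y → (x <ᵇ y) ≡ true
<ᵇ-true {x} {y} x<y with <ᵇ-cases x y
... | inj₁ (_ , e) = e
... | inj₂ (y≤x , _) = ⊥-elim (<⇒≱ x<y y≤x)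

<ᵇ-false : ∀ {x y} → y ≤ x → (x <ᵇ y) ≡ false
<ᵇ-false {x} {y} y≤x with <ᵇ-cases x y
... | inj₁ (x<y , _) = ⊥-elim (<⇒≱ x<y y≤x)
... | inj₂ (_ , e) = e

≤ᵇ-true : ∀ {x y} → x ≤ y → (x ≤ᵇ y) ≡ true
≤ᵇ-true {zero} _ = refl
≤ᵇ-true {suc x} x<y = <ᵇ-true x<y

≤ᵇ-false : ∀ {x y} → y < x → (x ≤ᵇ y) ≡ false
≤ᵇ-false {suc x} (s≤s y≤x) = <ᵇ-false y≤x

<ᵇ≡not<ᵇ : ∀ {x y} → x ≢ y → (x <ᵇ y) ≡ not (y <ᵇ x)
<ᵇ≡not<ᵇ {x} {y} x≢y with <ᵇ-cases x y | <ᵇ-cases y x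
... | inj₁ (x<y , _)  | inj₁ (y<x , _)  = ⊥-elim (<-asym x<y y<x)
... | inj₁ (_ , e₁)   | inj₂ (_ , e₂)   rewrite e₁ | e₂ = refl
... | inj₂ (_ , e₁)   | inj₁ (_ , e₂)   rewrite e₁ | e₂ = refl
... | inj₂ (y≤x , _)  | inj₂ (x≤y , _)  = ⊥-elim (x≢y (≤-antisym x≤y y≤x))

≡ᵇ-refl : ∀ x → (x ≡ᵇ x) ≡ true
≡ᵇ-refl zero = refl
≡ᵇ-refl (suc x) = ≡ᵇ-refl x

≡ᵇ-false : ∀ {x y} → x ≢ y → (x ≡ᵇ y) ≡ false
≡ᵇ-false {zero} {zero} x≢y = ⊥-elim (x≢y refl)
≡ᵇ-false {zero} {suc y} _ = refl
≡ᵇ-false {suc x} {zero} _ = refl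
≡ᵇ-false {suc x} {suc y} x≢y = ≡ᵇ-false (λ e → x≢y (cong suc e))

≡ᵇ⇒≡′ : ∀ {x y} → (x ≡ᵇ y) ≡ true → x ≡ y
≡ᵇ⇒≡′ {x} {y} e = ≡ᵇ⇒≡ x y (subst T (sym e) tt)

xor-not-not : ∀ a b → (not a xor not b) ≡ (a xor b)
xor-not-not true b = refl
xor-not-not false b = not-involutive b

true≢false : true ≢ false
true≢false ()

T⇒≡true : ∀ {b} → T b → b ≡ true
T⇒≡true {true} _ = refl

rank : List ℕ → ℕ → ℕ
rank [] y = 0
rank (x ∷ xs) y = if x <ᵇ y then suc (rank xs y) else rank xs y

rank-↭ : ∀ {xs ys} y → xs ↭ ys → rank xs y ≡ rank ys y
rank-↭ y ↭-refl = refl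
rank-↭ y (prep x p) with x <ᵇ y
... | true = cong suc (rank-↭ y p)
... | false = rank-↭ y p
rank-↭ y (swap a b p) with a <ᵇ y | b <ᵇ y
... | true  | true  = cong (λ r → suc (suc r)) (rank-↭ y p)
... | true  | false = cong suc (rank-↭ y p)
... | false | true  = cong suc (rank-↭ y p)
... | false | false = rank-↭ y p
rank-↭ y (↭-trans p q) = trans (rank-↭ y p) (rank-↭ y q)

rank-++ : ∀ xs ys z → rank (xs ++ ys) z ≡ rank xs z + rank ys z
rank-++ [] ys z = refl
rank-++ (x ∷ xs) ys z with x <ᵇ z
... | true = cong suc (rank-++ xs ys z)
... | false = rank-++ xs ys z

rank-singleton-self : ∀ y → rank [ y ] y ≡ 0
rank-singleton-self y rewrite <ᵇ-false {y} {y} ≤-refl = refl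

rank-monoʳ : ∀ xs {y z} → y ≤ z → rank xs y ≤ rank xs z
rank-monoʳ [] _ = z≤n
rank-monoʳ (x ∷ xs) {y} {z} y≤z with <ᵇ-cases x y | <ᵇ-cases x z
... | inj₁ (_ , e₁)   | inj₁ (_ , e₂)   rewrite e₁ | e₂ = s≤s (rank-monoʳ xs y≤z)
... | inj₁ (x<y , _)  | inj₂ (z≤x , _)  = ⊥-elim (<⇒≱ (<-≤-trans x<y y≤z) z≤x)
... | inj₂ (_ , e₁)   | inj₁ (_ , e₂)   rewrite e₁ | e₂ = m≤n⇒m≤1+n (rank-monoʳ xs y≤z)
... | inj₂ (_ , e₁)   | inj₂ (_ , e₂)   rewrite e₁ | e₂ = rank-monoʳ xs y≤z

rank≤length : ∀ xs y → rank xs y ≤ length xs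
rank≤length [] y = z≤n
rank≤length (x ∷ xs) y with x <ᵇ y
... | true = s≤s (rank≤length xs y)
... | false = m≤n⇒m≤1+n (rank≤length xs y)

rank-strictMonoʳ : ∀ {xs y z} → y ∈ xs → y < z → rank xs y < rank xs z
rank-strictMonoʳ {x ∷ xs} {y} {z} (here refl) y<z
  rewrite <ᵇ-false {y} {y} ≤-refl | <ᵇ-true y<z = s≤s (rank-monoʳ xs (<⇒≤ y<z))
rank-strictMonoʳ {x ∷ xs} {y} {z} (there y∈xs) y<z with <ᵇ-cases x y | <ᵇ-cases x z
... | inj₁ (_ , e₁)   | inj₁ (_ , e₂)   rewrite e₁ | e₂ = s≤s (rank-strictMonoʳ y∈xs y<z)
... | inj₁ (x<y , _)  | inj₂ (z≤x , _)  = ⊥-elim (<⇒≱ (<-trans x<y y<z) z≤x)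
... | inj₂ (_ , e₁)   | inj₁ (_ , e₂)   rewrite e₁ | e₂ = m≤n⇒m≤1+n (rank-strictMonoʳ y∈xs y<z)
... | inj₂ (_ , e₁)   | inj₂ (_ , e₂)   rewrite e₁ | e₂ = rank-strictMonoʳ y∈xs y<z

rank<length : ∀ {xs y} → y ∈ xs → rank xs y < length xs
rank<length {x ∷ xs} {y} (here refl) rewrite <ᵇ-false {y} {y} ≤-refl = s≤s (rank≤length xs y)
rank<length {x ∷ xs} {y} (there y∈xs) with x <ᵇ y
... | true = s≤s (rank<length y∈xs)
... | false = m≤n⇒m≤1+n (rank<length y∈xs)

rank-injective : ∀ {xs y z} → y ∈ xs → z ∈ xs → rank xs y ≡ rank xs z → y ≡ z
rank-injective y∈xs z∈xs e with <-cmp _ _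
... | tri< y<z _ _ = ⊥-elim (<-irrefl e (rank-strictMonoʳ y∈xs y<z))
... | tri≈ _ y≡z _ = y≡z
... | tri> _ _ z<y = ⊥-elim (<-irrefl (sym e) (rank-strictMonoʳ z∈xs z<y))

<ᵇ-rank : ∀ {xs y} z → y ∈ xs → (y <ᵇ z) ≡ (rank xs y <ᵇ rank xs z)
<ᵇ-rank {xs} {y} z y∈xs with <ᵇ-cases y z
... | inj₁ (y<z , e) rewrite e = sym (<ᵇ-true (rank-strictMonoʳ y∈xs y<z))
... | inj₂ (z≤y , e) rewrite e = sym (<ᵇ-false (rank-monoʳ xs z≤y))

<ᵇ-rank≤ᵇ : ∀ {xs y} z → y ∈ xs → z ≢ y → (z <ᵇ y) ≡ (rank xs z ≤ᵇ rank xs y)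
<ᵇ-rank≤ᵇ {xs} {y} z y∈xs z≢y with <ᵇ-cases z y
... | inj₁ (z<y , e) rewrite e = sym (≤ᵇ-true (rank-monoʳ xs (<⇒≤ z<y)))
... | inj₂ (y≤z , e) rewrite e with m≤n⇒m<n∨m≡n y≤z
...   | inj₁ y<z = sym (≤ᵇ-false (rank-strictMonoʳ y∈xs y<z))
...   | inj₂ y≡z = ⊥-elim (z≢y (sym y≡z))

at-++ˡ : ∀ xs ys k → k < length xs → at (xs ++ ys) (suc k) ≡ at xs (suc k)
at-++ˡ (x ∷ xs) ys zero _ = refl
at-++ˡ (x ∷ xs) ys (suc k) (s≤s k<) = at-++ˡ xs ys k k<

at-++ʳ : ∀ xs ys k → at (xs ++ ys) (suc (length xs + k)) ≡ at ys (suc k)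
at-++ʳ [] ys k = refl
at-++ʳ (x ∷ xs) ys k = at-++ʳ xs ys k

at-map : ∀ f xs k → k < length xs → at (map f xs) (suc k) ≡ f (at xs (suc k))
at-map f (x ∷ xs) zero _ = refl
at-map f (x ∷ xs) (suc k) (s≤s k<) = at-map f xs k k<

at-take : ∀ i xs k → k < i → at (take i xs) (suc k) ≡ at xs (suc k)
at-take (suc i) [] k _ = refl
at-take (suc i) (x ∷ xs) zero _ = refl
at-take (suc i) (x ∷ xs) (suc k) (s≤s k<i) = at-take i xs k k<i

at-drop : ∀ i xs k → at (drop i xs) (suc k) ≡ at xs (suc (i + k))
at-drop zero xs k = refl
at-drop (suc i) [] k = refl
at-drop (suc i) (x ∷ xs) k = at-drop i xs k

at-∈ : ∀ xs k → k < length xs → at xs (suc k) ∈ xs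
at-∈ (x ∷ xs) zero _ = here refl
at-∈ (x ∷ xs) (suc k) (s≤s k<) = there (at-∈ xs k k<)

∈⇒at : ∀ {x xs} → x ∈ xs → ∃ λ k → k < length xs × at xs (suc k) ≡ x
∈⇒at (here refl) = 0 , s≤s z≤n , refl
∈⇒at (there x∈xs) with ∈⇒at x∈xs
... | k , k< , e = suc k , s≤s k< , e

length-take-≤ : ∀ i (xs : List ℕ) → i ≤ length xs → length (take i xs) ≡ i
length-take-≤ i xs i≤ = trans (length-take i xs) (m≤n⇒m⊓n≡m i≤)

take-snoc : ∀ j (xs : List ℕ) → j < length xs → take (suc j) xs ≡ take j xs ++ [ at xs (suc j) ]
take-snoc zero (x ∷ xs) _ = refl
take-snoc (suc j) (x ∷ xs) (s≤s j<) = cong (x ∷_) (take-snoc j xs j<)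

take-++-≥ : ∀ m (xs ys : List ℕ) → length xs ≤ m → take m (xs ++ ys) ≡ xs ++ take (m ∸ length xs) ys
take-++-≥ m [] ys _ = refl
take-++-≥ (suc m) (x ∷ xs) ys (s≤s ≤m) = cong (x ∷_) (take-++-≥ m xs ys ≤m)

take-++-length : ∀ (xs ys : List ℕ) → take (length xs) (xs ++ ys) ≡ xs
take-++-length [] ys = refl
take-++-length (x ∷ xs) ys = cong (x ∷_) (take-++-length xs ys)

drop-++-length : ∀ (xs ys : List ℕ) → drop (length xs) (xs ++ ys) ≡ ys
drop-++-length [] ys = refl
drop-++-length (x ∷ xs) ys = drop-++-length xs ys

Unique-resp-↭ : ∀ {xs ys : List ℕ} → xs ↭ ys → Unique xs → Unique ys
Unique-resp-↭ p = Permₛ.Unique-resp-↭ (setoid ℕ) (↭⇒↭ₛ p)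

at-injective : ∀ {xs} → Unique xs → ∀ p q → p < length xs → q < length xs →
               at xs (suc p) ≡ at xs (suc q) → p ≡ q
at-injective {x ∷ xs} _ zero zero _ _ _ = refl
at-injective {x ∷ xs} (x∉ ∷ _) zero (suc q) _ (s≤s q<) e = ⊥-elim (All.lookup x∉ (at-∈ xs q q<) e)
at-injective {x ∷ xs} (x∉ ∷ _) (suc p) zero (s≤s p<) _ e = ⊥-elim (All.lookup x∉ (at-∈ xs p p<) (sym e))
at-injective {x ∷ xs} (_ ∷ u) (suc p) (suc q) (s≤s p<) (s≤s q<) e = cong suc (at-injective u p q p< q< e)

at∉take : ∀ {xs} → Unique xs → ∀ i k → i ≤ k → k < length xs → at xs (suc k) ∉ take i xs
at∉take {xs} u i k i≤k k< ∈take with ∈⇒at ∈take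
... | p , p<len , e = <⇒≱ p<i (subst (i ≤_) (sym p≡k) i≤k)
  where
  p<i : p < i
  p<i = <-≤-trans p<len (≤-trans (≤-reflexive (length-take i xs)) (m⊓n≤m i (length xs)))
  p≡k : p ≡ k
  p≡k = at-injective u p k (<-≤-trans p<i (≤-trans i≤k (<⇒≤ k<))) k< (trans (sym (at-take i xs p p<i)) e)

at-suc≢at : ∀ {xs} → Unique xs → ∀ k → suc k < length xs → at xs (suc (suc k)) ≢ at xs (suc k)
at-suc≢at u k k< e = 1+n≢n (at-injective u (suc k) k k< (<-trans (n<1+n k) k<) e)

perm-of-subset : ∀ {xs ys : List ℕ} → Unique xs → (∀ x → x ∈ xs → x ∈ ys) → length xs ≡ length ys → xs ↭ ys
perm-of-subset {[]} {[]} _ _ _ = ↭-refl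
perm-of-subset {x ∷ xs} {ys} (x∉ ∷ u) ⊆ys e with ∈-∃++ (⊆ys x (here refl))
... | as , bs , refl = ↭-trans (prep x (perm-of-subset u ⊆as++bs len)) (↭-sym (shift x as bs))
  where
  ⊆as++bs : ∀ z → z ∈ xs → z ∈ as ++ bs
  ⊆as++bs z z∈ with ∈-resp-↭ (shift x as bs) (⊆ys z (there z∈))
  ... | here z≡x = ⊥-elim (All.lookup x∉ z∈ (sym z≡x))
  ... | there z∈′ = z∈′
  len : length xs ≡ length (as ++ bs)
  len = suc-injective (trans e (↭-length (shift x as bs)))

sort-strictly↗ : ∀ {xs} → Unique xs → AllPairs _<_ (sort xs)
sort-strictly↗ {xs} u = AllPairs.zipWith (λ (x≤y , x≢y) → ≤∧≢⇒< x≤y x≢y)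
  (Linked.Linked⇒AllPairs ≤-trans (sort-↗ xs) , Unique-resp-↭ (↭-sym (sort-↭ xs)) u)

rank-below : ∀ {y ys} → All (y <_) ys → rank ys y ≡ 0
rank-below [] = refl
rank-below {y} {z ∷ zs} (y<z ∷ a) rewrite <ᵇ-false {z} {y} (<⇒≤ y<z) = rank-below a

posOf-strictly↗ : ∀ {xs x} → AllPairs _<_ xs → x ∈ xs → posOf x xs ≡ suc (rank xs x)
posOf-strictly↗ {y ∷ ys} {x} (y< ∷ _) (here refl)
  rewrite ≡ᵇ-refl x | <ᵇ-false {x} {x} ≤-refl = cong suc (sym (rank-below y<))
posOf-strictly↗ {y ∷ ys} {x} (y< ∷ s) (there x∈)
  rewrite ≡ᵇ-false {x} {y} (>⇒≢ (All.lookup y< x∈)) | <ᵇ-true (All.lookup y< x∈) =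
  cong suc (posOf-strictly↗ s x∈)

rank-at-strictly↗ : ∀ {xs} → AllPairs _<_ xs → ∀ j → j < length xs →
                    at xs (suc j) ∈ xs × rank xs (at xs (suc j)) ≡ j
rank-at-strictly↗ {y ∷ ys} (y< ∷ _) zero _ rewrite <ᵇ-false {y} {y} ≤-refl = here refl , rank-below y<
rank-at-strictly↗ {y ∷ ys} (y< ∷ s) (suc j) (s≤s j<) with rank-at-strictly↗ s j j<
... | z∈ , r rewrite <ᵇ-true (All.lookup y< z∈) = there z∈ , cong suc r

-- fl L σ is by definition map (flipMap (take L σ) L) (take L σ) ++ drop L σ.
flipMap : List ℕ → ℕ → ℕ → ℕ
flipMap P L x = at (sort P) (suc (L ∸ posOf x (sort P)))

flipMap-spec : ∀ {P L x} → Unique P → length P ≡ L → x ∈ P →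
               flipMap P L x ∈ P × rank P (flipMap P L x) + suc (rank P x) ≡ L
flipMap-spec {P} {L} {x} u len x∈P = ∈-resp-↭ (sort-↭ P) (subst (_∈ sort P) (sym fx≡) fx∈) , rank-sum
  where
  s : AllPairs _<_ (sort P)
  s = sort-strictly↗ u
  r : ℕ
  r = rank P x
  r<L : suc r ≤ L
  r<L = subst (suc r ≤_) len (rank<length x∈P)
  j<len : L ∸ suc r < length (sort P)
  j<len = subst (L ∸ suc r <_) (sym (trans (↭-length (sort-↭ P)) len)) (∸-monoʳ-< {L} {suc r} {0} (s≤s z≤n) r<L)
  fx≡ : flipMap P L x ≡ at (sort P) (suc (L ∸ suc r))
  fx≡ = cong (λ p → at (sort P) (suc (L ∸ p)))
             (trans (posOf-strictly↗ s (∈-resp-↭ (↭-sym (sort-↭ P)) x∈P)) (cong suc (rank-↭ x (sort-↭ P))))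
  fx∈ : at (sort P) (suc (L ∸ suc r)) ∈ sort P
  fx∈ = proj₁ (rank-at-strictly↗ s (L ∸ suc r) j<len)
  rank-sum : rank P (flipMap P L x) + suc r ≡ L
  rank-sum = begin
    rank P (flipMap P L x) + suc r              ≡⟨ cong (λ y → rank P y + suc r) fx≡ ⟩
    rank P (at (sort P) (suc (L ∸ suc r))) + suc r ≡⟨ cong (_+ suc r) (sym (rank-↭ _ (sort-↭ P))) ⟩
    rank (sort P) (at (sort P) (suc (L ∸ suc r))) + suc r
      ≡⟨ cong (_+ suc r) (proj₂ (rank-at-strictly↗ s (L ∸ suc r) j<len)) ⟩
    L ∸ suc r + suc r                             ≡⟨ m∸n+n≡m r<L ⟩
    L ∎
    where open ≡-Reasoning

Des-inside : ∀ u k → suc k < length u → Des u (suc k) ≡ (at u (suc (suc k)) <ᵇ at u (suc k))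
Des-inside u k k< rewrite <ᵇ-true k< = refl

module Flip {σ : List ℕ} (uσ : Unique σ) (L : ℕ) (L≤ : L ≤ length σ) where
  P : List ℕ
  P = take L σ
  F : ℕ → ℕ
  F = flipMap P L
  v : List ℕ
  v = fl L σ

  uP : Unique P
  uP = Unique.take⁺ L uσ

  length-P : length P ≡ L
  length-P = length-take-≤ L σ L≤

  length-FP : length (map F P) ≡ L
  length-FP = trans (length-map F P) length-P

  length-fl : length v ≡ length σ
  length-fl = begin
    length (map F P ++ drop L σ)        ≡⟨ length-++ (map F P) ⟩
    length (map F P) + length (drop L σ) ≡⟨ cong₂ _+_ length-FP (length-drop L σ) ⟩
    L + (length σ ∸ L)                   ≡⟨ m+[n∸m]≡n L≤ ⟩
    length σ ∎
    where open ≡-Reasoning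

  at∈P : ∀ p → p < L → at σ (suc p) ∈ P
  at∈P p p<L = subst (_∈ P) (at-take L σ p p<L) (at-∈ P p (subst (p <_) (sym length-P) p<L))

  at-fl-low : ∀ p → p < L → at v (suc p) ≡ F (at σ (suc p))
  at-fl-low p p<L = begin
    at (map F P ++ drop L σ) (suc p) ≡⟨ at-++ˡ (map F P) (drop L σ) p (subst (p <_) (sym length-FP) p<L) ⟩
    at (map F P) (suc p)             ≡⟨ at-map F P p (subst (p <_) (sym length-P) p<L) ⟩
    F (at P (suc p))                 ≡⟨ cong F (at-take L σ p p<L) ⟩
    F (at σ (suc p)) ∎
    where open ≡-Reasoning

  at-fl-high : ∀ k → L ≤ k → at v (suc k) ≡ at σ (suc k)
  at-fl-high k L≤k = begin
    at v (suc k)                      ≡⟨ cong (λ l → at v (suc l)) (sym k≡) ⟩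
    at v (suc (length (map F P) + d)) ≡⟨ at-++ʳ (map F P) (drop L σ) d ⟩
    at (drop L σ) (suc d)             ≡⟨ at-drop L σ d ⟩
    at σ (suc (L + d))                ≡⟨ cong (λ l → at σ (suc l)) (m+[n∸m]≡n L≤k) ⟩
    at σ (suc k) ∎
    where
    open ≡-Reasoning
    d : ℕ
    d = k ∸ L
    k≡ : length (map F P) + d ≡ k
    k≡ = trans (cong (_+ d) length-FP) (m+[n∸m]≡n L≤k)

  F-spec : ∀ {x} → x ∈ P → F x ∈ P × rank P (F x) + suc (rank P x) ≡ L
  F-spec = flipMap-spec uP length-P

  at-fl-spec : ∀ p → p < L →
               at v (suc p) ∈ P × rank P (at v (suc p)) + suc (rank P (at σ (suc p))) ≡ L
  at-fl-spec p p<L rewrite at-fl-low p p<L = F-spec (at∈P p p<L)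

  -- Ranks in P are complementary (they sum to L - 1), so comparisons are reversed.
  <ᵇ-fl-reverse : ∀ p q → p < L → q < L → (at v (suc p) <ᵇ at v (suc q)) ≡ (at σ (suc q) <ᵇ at σ (suc p))
  <ᵇ-fl-reverse p q p<L q<L = begin
    (at v (suc p) <ᵇ at v (suc q))                   ≡⟨ <ᵇ-rank _ (proj₁ (at-fl-spec p p<L)) ⟩
    (rank P (at v (suc p)) <ᵇ rank P (at v (suc q)))
      ≡⟨ complement-<ᵇ (trans (proj₂ (at-fl-spec p p<L)) (sym (proj₂ (at-fl-spec q q<L)))) ⟩
    (rank P (at σ (suc q)) <ᵇ rank P (at σ (suc p))) ≡⟨ sym (<ᵇ-rank _ (at∈P q q<L)) ⟩
    (at σ (suc q) <ᵇ at σ (suc p)) ∎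
    where
    open ≡-Reasoning
    complement-<ᵇ : ∀ {a b c d} → a + suc c ≡ b + suc d → (a <ᵇ b) ≡ (d <ᵇ c)
    complement-<ᵇ {a} {b} {c} {d} e with <ᵇ-cases a b | <ᵇ-cases d c
    ... | inj₁ (_ , e₁) | inj₁ (_ , e₂) rewrite e₁ | e₂ = refl
    ... | inj₂ (_ , e₁) | inj₂ (_ , e₂) rewrite e₁ | e₂ = refl
    ... | inj₁ (a<b , _) | inj₂ (c≤d , _) = ⊥-elim (<-irrefl e (+-mono-<-≤ a<b (s≤s c≤d)))
    ... | inj₂ (b≤a , _) | inj₁ (d<c , _) = ⊥-elim (<-irrefl (sym e) (+-mono-≤-< b≤a (s≤s d<c)))

  Des-fl-low : ∀ k → suc k < L → Des v (suc k) ≡ not (Des σ (suc k))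
  Des-fl-low k k<L = begin
    Des v (suc k)                             ≡⟨ Des-inside v k (subst (suc k <_) (sym length-fl) k<) ⟩
    (at v (suc (suc k)) <ᵇ at v (suc k))      ≡⟨ <ᵇ-fl-reverse (suc k) k k<L (<-trans (n<1+n k) k<L) ⟩
    (at σ (suc k) <ᵇ at σ (suc (suc k)))      ≡⟨ <ᵇ≡not<ᵇ (λ e → at-suc≢at uσ k k< (sym e)) ⟩
    not (at σ (suc (suc k)) <ᵇ at σ (suc k))  ≡⟨ cong not (sym (Des-inside σ k k<)) ⟩
    not (Des σ (suc k)) ∎
    where
    open ≡-Reasoning
    k< : suc k < length σ
    k< = <-≤-trans k<L L≤

  Des-fl-high : ∀ k → L < k → Des v k ≡ Des σ k
  Des-fl-high (suc k) (s≤s L≤k) = begin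
    Des v (suc k)
      ≡⟨ cong (λ l → (1 ≤ᵇ suc k) ∧ ((suc k <ᵇ l) ∧ (at v (suc (suc k)) <ᵇ at v (suc k)))) length-fl ⟩
    (1 ≤ᵇ suc k) ∧ ((suc k <ᵇ length σ) ∧ (at v (suc (suc k)) <ᵇ at v (suc k)))
      ≡⟨ cong₂ (λ a b → (1 ≤ᵇ suc k) ∧ ((suc k <ᵇ length σ) ∧ (a <ᵇ b)))
               (at-fl-high (suc k) (m≤n⇒m≤1+n L≤k)) (at-fl-high k L≤k) ⟩
    Des σ (suc k) ∎
    where open ≡-Reasoning

  rank-complement-unique : ∀ {y z w} → y ∈ P → z ∈ P →
    rank P y + suc (rank P w) ≡ L → rank P w + suc (rank P z) ≡ L → y ≡ z
  rank-complement-unique {y} {z} {w} y∈P z∈P e₁ e₂ = rank-injective y∈P z∈P (+-cancelʳ-≡ _ _ _ (begin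
    rank P y + suc (rank P w) ≡⟨ trans e₁ (sym e₂) ⟩
    rank P w + suc (rank P z) ≡⟨ +-suc (rank P w) _ ⟩
    suc (rank P w + rank P z) ≡⟨ cong suc (+-comm (rank P w) _) ⟩
    suc (rank P z + rank P w) ≡⟨ sym (+-suc (rank P z) _) ⟩
    rank P z + suc (rank P w) ∎))
    where open ≡-Reasoning

  F-involutive : ∀ {x} → x ∈ P → F (F x) ≡ x
  F-involutive x∈P = rank-complement-unique (proj₁ (F-spec Fx∈P)) x∈P (proj₂ (F-spec Fx∈P)) (proj₂ (F-spec x∈P))
    where Fx∈P = proj₁ (F-spec x∈P)

  FP↭P : map F P ↭ P
  FP↭P = ↭-sym (perm-of-subset uP
    (λ x x∈P → subst (_∈ map F P) (F-involutive x∈P) (∈-map⁺ F (proj₁ (F-spec x∈P))))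
    (sym (length-map F P)))

  fl-↭ : v ↭ σ
  fl-↭ = subst (v ↭_) (take++drop≡id L σ) (++⁺ʳ (drop L σ) FP↭P)

  Unique-fl : Unique v
  Unique-fl = Unique-resp-↭ (↭-sym fl-↭) uσ

  take-fl-↭ : ∀ m → L ≤ m → take m v ↭ take m σ
  take-fl-↭ m L≤m = subst₂ _↭_
    (sym (take-++-≥ m (map F P) (drop L σ) (≤-trans (≤-reflexive length-FP) L≤m)))
    (trans (cong (λ l → P ++ take (m ∸ l) (drop L σ)) (trans length-FP (sym length-P)))
      (trans (sym (take-++-≥ m P (drop L σ) (≤-trans (≤-reflexive length-P) L≤m)))
        (cong (take m) (take++drop≡id L σ))))
    (++⁺ʳ (take (m ∸ length (map F P)) (drop L σ)) FP↭P)

  fl-involutive : fl L v ≡ σ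
  fl-involutive = begin
    fl L v                                  ≡⟨ cong₂ (λ t d → map (flipMap t L) t ++ d) take-v drop-v ⟩
    map (flipMap (map F P) L) (map F P) ++ drop L σ ≡⟨ cong (_++ drop L σ) (sym (map-∘ P)) ⟩
    map (flipMap (map F P) L ∘ F) P ++ drop L σ ≡⟨ cong (_++ drop L σ) (map-id-local (All.tabulate F′∘F≡id)) ⟩
    P ++ drop L σ                               ≡⟨ take++drop≡id L σ ⟩
    σ ∎
    where
    open ≡-Reasoning
    take-v : take L v ≡ map F P
    take-v = subst (λ l → take l v ≡ map F P) length-FP (take-++-length (map F P) (drop L σ))
    drop-v : drop L v ≡ drop L σ
    drop-v = subst (λ l → drop l v ≡ drop L σ) length-FP (drop-++-length (map F P) (drop L σ))
    F′ : ℕ → ℕ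
    F′ = flipMap (map F P) L
    F′∘F≡id : ∀ {x} → x ∈ P → F′ (F x) ≡ x
    F′∘F≡id {x} x∈P = rank-complement-unique (∈-resp-↭ FP↭P (proj₁ spec)) x∈P
      (trans (cong₂ (λ a b → a + suc b) (sym (rank-↭ _ FP↭P)) (sym (rank-↭ _ FP↭P))) (proj₂ spec))
      (proj₂ (F-spec x∈P))
      where
      spec : F′ (F x) ∈ map F P × rank (map F P) (F′ (F x)) + suc (rank (map F P) (F x)) ≡ L
      spec = flipMap-spec (Unique-resp-↭ (↭-sym FP↭P) uP) length-FP
               (∈-resp-↭ (↭-sym FP↭P) (proj₁ (F-spec x∈P)))

module Boundary {u : List ℕ} (uu : Unique u) (j′ : ℕ) (j< : suc j′ < length u) where
  private
    j : ℕ
    j = suc j′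
    P : List ℕ
    P = take j u
    next : ℕ
    next = at u (suc j)
    last : ℕ
    last = at u j
    open Flip uu j (<⇒≤ j<) using (at∈P; at-fl-spec; at-fl-high; length-fl)
    last∈P : last ∈ P
    last∈P = at∈P j′ ≤-refl
    next∉P : next ∉ P
    next∉P = at∉take uu j j ≤-refl j<

  Des-boundary : Des u j ≡ (rank P next ≤ᵇ rank P last)
  Des-boundary = trans (Des-inside u j′ j<) (<ᵇ-rank≤ᵇ next last∈P (λ e → next∉P (subst (_∈ P) (sym e) last∈P)))

  Des-fl-boundary : Des (fl j u) j ≡ (rank P next ≤ᵇ (j′ ∸ rank P last))
  Des-fl-boundary = begin
    Des (fl j u) j                                     ≡⟨ Des-inside (fl j u) j′ (subst (j <_) (sym length-fl) j<) ⟩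
    (at (fl j u) (suc j) <ᵇ at (fl j u) j)             ≡⟨ cong (_<ᵇ at (fl j u) j) next-fixed ⟩
    (next <ᵇ at (fl j u) j)
      ≡⟨ <ᵇ-rank≤ᵇ next flipped-last∈P (λ e → next∉P (subst (_∈ P) (sym e) flipped-last∈P)) ⟩
    (rank P next ≤ᵇ rank P (at (fl j u) j))             ≡⟨ cong (rank P next ≤ᵇ_) flipped-rank ⟩
    (rank P next ≤ᵇ (j′ ∸ rank P last)) ∎
    where
    open ≡-Reasoning
    flipped-last∈P : at (fl j u) j ∈ P
    flipped-last∈P = proj₁ (at-fl-spec j′ ≤-refl)
    next-fixed : at (fl j u) (suc j) ≡ next
    next-fixed = at-fl-high j ≤-refl
    flipped-rank : rank P (at (fl j u) j) ≡ j′ ∸ rank P last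
    flipped-rank = trans (sym (m+n∸n≡m _ (rank P last)))
      (cong (_∸ rank P last) (suc-injective (trans (sym (+-suc _ (rank P last))) (proj₂ (at-fl-spec j′ ≤-refl)))))

<ᵇ-suc≡not<ᵇ : ∀ y b → (y <ᵇ suc b) ≡ not (b <ᵇ y)
<ᵇ-suc≡not<ᵇ y b with <ᵇ-cases b y
... | inj₁ (b<y , e) rewrite e = <ᵇ-false b<y
... | inj₂ (y≤b , e) rewrite e = <ᵇ-true (s≤s y≤b)

rank-suc-∉ : ∀ {xs b} → b ∉ xs → rank xs (suc b) ≡ rank xs b
rank-suc-∉ {[]} _ = refl
rank-suc-∉ {x ∷ xs} {b} b∉ with <-cmp x b
... | tri< x<b _ _ rewrite <ᵇ-true (m≤n⇒m≤1+n x<b) | <ᵇ-true x<b = cong suc (rank-suc-∉ (b∉ ∘ there))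
... | tri≈ _ x≡b _ = ⊥-elim (b∉ (here (sym x≡b)))
... | tri> _ _ b<x rewrite <ᵇ-false {x} {suc b} b<x | <ᵇ-false (<⇒≤ b<x) = rank-suc-∉ (b∉ ∘ there)

rank-suc-∈ : ∀ {xs b} → Unique xs → b ∈ xs → rank xs (suc b) ≡ suc (rank xs b)
rank-suc-∈ {x ∷ xs} {b} (b∉ ∷ _) (here refl) rewrite <ᵇ-true (n<1+n b) | <ᵇ-false {b} {b} ≤-refl =
  cong suc (rank-suc-∉ (λ b∈ → All.lookup b∉ b∈ refl))
rank-suc-∈ {x ∷ xs} {b} (x∉ ∷ u) (there b∈) with <-cmp x b
... | tri< x<b _ _ rewrite <ᵇ-true (m≤n⇒m≤1+n x<b) | <ᵇ-true x<b = cong suc (rank-suc-∈ u b∈)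
... | tri≈ _ x≡b _ = ⊥-elim (All.lookup x∉ b∈ x≡b)
... | tri> _ _ b<x rewrite <ᵇ-false {x} {suc b} b<x | <ᵇ-false (<⇒≤ b<x) = rank-suc-∈ u b∈

rank-reversed : ∀ (xs ys : List ℕ) a b → length xs ≡ length ys →
  (∀ l → l < length ys → (at xs (suc l) <ᵇ a) ≡ (b <ᵇ at ys (suc l))) →
  rank xs a + rank ys (suc b) ≡ length ys
rank-reversed [] [] a b _ _ = refl
rank-reversed (x ∷ xs) (y ∷ ys) a b e h
  with h 0 (s≤s z≤n) | rank-reversed xs ys a b (suc-injective e) (λ l l< → h (suc l) (s≤s l<))
... | h₀ | ih rewrite <ᵇ-suc≡not<ᵇ y b | h₀ with b <ᵇ y
...   | true = cong suc ih
...   | false = trans (+-suc _ _) (cong suc ih)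

≤ᵇ-complement : ∀ {a b c d n} → a + b ≡ suc n → c + d ≡ n → (a ≤ᵇ (n ∸ c)) ≡ not (b ≤ᵇ (n ∸ d))
≤ᵇ-complement {a} {b} {c} {d} e₁ refl rewrite m+n∸m≡n c d | m+n∸n≡m c d with ≤ᵇ-cases a d | ≤ᵇ-cases b c
... | inj₁ (a≤d , _) | inj₁ (b≤c , _) =
  ⊥-elim (<-irrefl refl (subst (_≤ c + d) e₁ (subst (a + b ≤_) (+-comm d c) (+-mono-≤ a≤d b≤c))))
... | inj₁ (_ , e₂) | inj₂ (_ , e₃) rewrite e₂ | e₃ = refl
... | inj₂ (_ , e₂) | inj₁ (_ , e₃) rewrite e₂ | e₃ = refl
... | inj₂ (d<a , _) | inj₂ (c<b , _) =
  ⊥-elim (<-irrefl refl (≤-trans (s≤s (≤-reflexive (+-comm c d))) (subst (_≤ c + d) (+-suc d c) (≤-pred too-big))))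
  where
  too-big : suc d + suc c ≤ suc (c + d)
  too-big = subst (suc d + suc c ≤_) e₁ (+-mono-≤ d<a c<b)

-- A flip at L turns the prefix of length j < L into its complement, and this negates the
-- effect of a subsequent j-flip on position j.
Des-fl-after-fl : ∀ {u} → Unique u → ∀ L → L ≤ length u → ∀ j′ → suc j′ < L →
  Des (fl (suc j′) (fl L u)) (suc j′) ≡ not (Des (fl (suc j′) u) (suc j′))
Des-fl-after-fl {u} uu L L≤ j′ j<L = begin
  Des (fl j v) j                           ≡⟨ Boundary.Des-fl-boundary uv j′ j<v ⟩
  (rank Pv (at v (suc j)) ≤ᵇ (j′ ∸ rank Pv (at v j)))
    ≡⟨ ≤ᵇ-complement {rank Pv (at v (suc j))} {rank Pu (at u (suc j))} {rank Pv (at v j)} {rank Pu (at u j)}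
                     next-ranks last-ranks ⟩
  not (rank Pu (at u (suc j)) ≤ᵇ (j′ ∸ rank Pu (at u j))) ≡⟨ cong not (sym (Boundary.Des-fl-boundary uu j′ j<u)) ⟩
  not (Des (fl j u) j) ∎
  where
  open ≡-Reasoning
  open Flip uu L L≤ using (v; Unique-fl; length-fl; <ᵇ-fl-reverse)
  j : ℕ
  j = suc j′
  uv : Unique v
  uv = Unique-fl
  j<u : j < length u
  j<u = <-≤-trans j<L L≤
  j<v : j < length v
  j<v = subst (j <_) (sym length-fl) j<u
  Pu : List ℕ
  Pu = take j u
  Pv : List ℕ
  Pv = take j v
  length-Pu : length Pu ≡ j
  length-Pu = length-take-≤ j u (<⇒≤ j<u)
  same-length : length Pv ≡ length Pu
  same-length = trans (length-take-≤ j v (<⇒≤ j<v)) (sym length-Pu)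
  reversed : ∀ x → x < L → ∀ l → l < length Pu → (at Pv (suc l) <ᵇ at v (suc x)) ≡ (at u (suc x) <ᵇ at Pu (suc l))
  reversed x x<L l l< = trans (cong (_<ᵇ at v (suc x)) (at-take j v l l<j))
    (trans (<ᵇ-fl-reverse l x (<-trans l<j j<L) x<L) (cong (at u (suc x) <ᵇ_) (sym (at-take j u l l<j))))
    where
    l<j : l < j
    l<j = subst (l <_) length-Pu l<
  next-ranks : rank Pv (at v (suc j)) + rank Pu (at u (suc j)) ≡ j
  next-ranks = trans (cong (rank Pv (at v (suc j)) +_) (sym (rank-suc-∉ (at∉take uu j j ≤-refl j<u))))
    (trans (rank-reversed Pv Pu _ _ same-length (reversed j j<L)) length-Pu)
  last-ranks : rank Pv (at v j) + rank Pu (at u j) ≡ j′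
  last-ranks = suc-injective (trans (sym (+-suc _ _))
    (trans (cong (rank Pv (at v j) +_) (sym (rank-suc-∈ (Unique.take⁺ j uu) (Flip.at∈P uu j (<⇒≤ j<u) j′ ≤-refl))))
      (trans (rank-reversed Pv Pu _ _ same-length (reversed j′ (<-trans (n<1+n j′) j<L))) length-Pu)))

toggleBelow : ℕ → ℕ → Bool → Bool
toggleBelow i k b = ((1 ≤ᵇ k) ∧ (k <ᵇ i)) xor b

toggleBelow-low : ∀ {i k} b → 1 ≤ k → k < i → toggleBelow i k b ≡ not b
toggleBelow-low {i} {suc k} b _ k<i rewrite <ᵇ-true k<i = refl

toggleBelow-high : ∀ {i k} b → i ≤ k → toggleBelow i k b ≡ b
toggleBelow-high {i} {zero} b _ = refl
toggleBelow-high {i} {suc k} b i≤k rewrite <ᵇ-false i≤k = refl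

toggleBelow-involutive : ∀ i k b → toggleBelow i k (toggleBelow i k b) ≡ b
toggleBelow-involutive i k b with (1 ≤ᵇ k) ∧ (k <ᵇ i)
... | true = not-involutive b
... | false = refl

module _ {u : List ℕ} (uu : Unique u) where

  Des-fl-toggles : ∀ i → i < length u → Des (fl i u) i ≡ Des u i →
    ∀ k → Des (fl i u) k ≡ toggleBelow i k (Des u k)
  Des-fl-toggles i i< _ zero = refl
  Des-fl-toggles i i< same (suc k) with <-cmp (suc k) i
  ... | tri< k<i _ _ rewrite <ᵇ-true k<i = Flip.Des-fl-low uu i (<⇒≤ i<) k k<i
  ... | tri≈ _ refl _ rewrite <ᵇ-false {suc k} ≤-refl = same
  ... | tri> _ _ i<k rewrite <ᵇ-false (<⇒≤ i<k) = Flip.Des-fl-high uu i (<⇒≤ i<) (suc k) i<k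

  Des-fl-pred-toggles : ∀ i → 2 ≤ i → i < length u → Des (fl (i ∸ 1) u) (i ∸ 1) ≡ not (Des u (i ∸ 1)) →
    ∀ k → Des (fl (i ∸ 1) u) k ≡ toggleBelow i k (Des u k)
  Des-fl-pred-toggles (suc i′) (s≤s _) _ _ zero = refl
  Des-fl-pred-toggles (suc i′) (s≤s _) i< flipped (suc k) with <-cmp (suc k) i′
  ... | tri< k<i _ _ rewrite <ᵇ-true (<-trans k<i (n<1+n i′)) =
    Flip.Des-fl-low uu i′ (<⇒≤ (<-trans (n<1+n i′) i<)) k k<i
  ... | tri≈ _ refl _ rewrite <ᵇ-true (n<1+n (suc k)) = flipped
  ... | tri> _ _ i<k rewrite <ᵇ-false {suc k} {suc i′} i<k =
    Flip.Des-fl-high uu i′ (<⇒≤ (<-trans (n<1+n i′) i<)) (suc k) i<k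

isSpike-xor : ∀ D n k → isSpike D n k ≡ (2 ≤ᵇ k) ∧ ((k ≤ᵇ n ∸ 1) ∧ (D k xor D (k ∸ 1)))
isSpike-xor D n k with D k | D (k ∸ 1)
... | true  | true  = refl
... | true  | false = refl
... | false | true  = refl
... | false | false = refl

isSpike-toggleBelow : ∀ (Dv Du : ℕ → Bool) n i → Du (i ∸ 1) ≡ not (Du i) →
  (∀ k → Dv k ≡ toggleBelow i k (Du k)) → ∀ k → isSpike Dv n k ≡ (isSpike Du n k ∧ not (k ≡ᵇ i))
isSpike-toggleBelow Dv Du n i spike toggled k rewrite isSpike-xor Dv n k | isSpike-xor Du n k | toggled k with k
... | zero = refl
... | suc zero = refl
... | suc (suc k′) rewrite toggled (suc k′) with <-cmp (suc (suc k′)) i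
...   | tri< k<i _ _
  rewrite <ᵇ-true k<i | <ᵇ-true (<-trans (n<1+n (suc k′)) k<i) | ≡ᵇ-false (<⇒≢ k<i)
        | xor-not-not (Du (suc (suc k′))) (Du (suc k′)) = sym (∧-identityʳ _)
...   | tri≈ _ refl _ rewrite <ᵇ-false {suc (suc k′)} ≤-refl | <ᵇ-true (n<1+n (suc k′)) | ≡ᵇ-refl k′ | spike
        | not-involutive (Du (suc (suc k′))) | xor-same (Du (suc (suc k′)))
  = trans (∧-zeroʳ _) (sym (∧-zeroʳ _))
...   | tri> _ _ i<k rewrite <ᵇ-false (<⇒≤ i<k) | <ᵇ-false {suc k′} {i} (≤-pred i<k) | ≡ᵇ-false (>⇒≢ i<k)
  = sym (∧-identityʳ _)

_⇔ᵇ_ : Bool → Bool → Bool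
a ⇔ᵇ b = not (a xor b)

⇔ᵇ-refl : ∀ a → (a ⇔ᵇ a) ≡ true
⇔ᵇ-refl true = refl
⇔ᵇ-refl false = refl

⇔ᵇ-sym : ∀ a b → (a ⇔ᵇ b) ≡ (b ⇔ᵇ a)
⇔ᵇ-sym a b = cong not (xor-comm a b)

⇔ᵇ-not : ∀ a b → (not a ⇔ᵇ not b) ≡ (a ⇔ᵇ b)
⇔ᵇ-not a b = cong not (xor-not-not a b)

⇔ᵇ⇒≡ : ∀ {a b} → (a ⇔ᵇ b) ≡ true → a ≡ b
⇔ᵇ⇒≡ {true} {true} _ = refl
⇔ᵇ⇒≡ {false} {false} _ = refl

≢⇒⇔ᵇ≡false : ∀ {a b} → a ≢ b → (a ⇔ᵇ b) ≡ false
≢⇒⇔ᵇ≡false {a} {b} a≢b rewrite ¬-not a≢b | xor-comm (not b) b | xor-inverseʳ b = refl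

∈⇒∈ᵇ : ∀ {x xs} → x ∈ xs → (x ∈ᵇ xs) ≡ true
∈⇒∈ᵇ {x} (here refl) rewrite ≡ᵇ-refl x = refl
∈⇒∈ᵇ {x} {y ∷ ys} (there x∈) rewrite ∈⇒∈ᵇ {x} {ys} x∈ with x ≡ᵇ y
... | true = refl
... | false = refl

∈ᵇ-filterᵇ : ∀ i p R → (i ∈ᵇ filterᵇ p R) ≡ ((i ∈ᵇ R) ∧ p i)
∈ᵇ-filterᵇ i p [] = refl
∈ᵇ-filterᵇ i p (y ∷ ys) with i ≡ᵇ y in i≡ᵇy
... | false with p y
...   | true rewrite i≡ᵇy = ∈ᵇ-filterᵇ i p ys
...   | false = ∈ᵇ-filterᵇ i p ys
∈ᵇ-filterᵇ i p (y ∷ ys) | true with ≡ᵇ⇒≡′ {i} {y} i≡ᵇy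
... | refl with p i in pi
...   | true rewrite ≡ᵇ-refl i = refl
...   | false = trans (∈ᵇ-filterᵇ i p ys) (trans (cong ((i ∈ᵇ ys) ∧_) pi) (∧-zeroʳ _))

filterᵇ-filterᵇ : ∀ (p q : ℕ → Bool) R → filterᵇ q (filterᵇ p R) ≡ filterᵇ (λ k → p k ∧ q k) R
filterᵇ-filterᵇ p q [] = refl
filterᵇ-filterᵇ p q (y ∷ ys) with p y
... | false = filterᵇ-filterᵇ p q ys
... | true with q y
...   | true = cong (y ∷_) (filterᵇ-filterᵇ p q ys)
...   | false = filterᵇ-filterᵇ p q ys

filterᵇ-cong : ∀ {p q : ℕ → Bool} {R} → All (λ y → p y ≡ q y) R → filterᵇ p R ≡ filterᵇ q R
filterᵇ-cong {R = []} [] = refl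
filterᵇ-cong {q = q} {R = y ∷ ys} (e ∷ es) rewrite e with q y
... | true = cong (y ∷_) (filterᵇ-cong es)
... | false = filterᵇ-cong es

spikeEq-refl : ∀ xs → spikeEq xs xs ≡ true
spikeEq-refl xs with ≡-dec _≟_ xs xs
... | yes _ = refl
... | no xs≢xs = ⊥-elim (xs≢xs refl)

spikeEq-≢ : ∀ {xs ys} → xs ≢ ys → spikeEq xs ys ≡ false
spikeEq-≢ {xs} {ys} xs≢ys with ≡-dec _≟_ xs ys
... | yes xs≡ys = ⊥-elim (xs≢ys xs≡ys)
... | no _ = refl

∈ᵇ-range : ∀ i n → 2 ≤ i → i ≤ n ∸ 1 → (i ∈ᵇ range 2 (n ∸ 1)) ≡ true
∈ᵇ-range i n 2≤i i≤ = ∈⇒∈ᵇ (subst (_∈ range 2 (n ∸ 1)) (m+[n∸m]≡n 2≤i) (∈-map⁺ (2 +_) (∈-upTo⁺ (∸-monoˡ-< (s≤s i≤) 2≤i))))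

∈ᵇ-remove : ∀ i R → (i ∈ᵇ remove i R) ≡ false
∈ᵇ-remove i R rewrite ∈ᵇ-filterᵇ i (λ k → not (k ≡ᵇ i)) R | ≡ᵇ-refl i = ∧-zeroʳ _

SpikeP-length : ∀ v n → length v ≡ n → SpikeP v ≡ filterᵇ (isSpike (Des v) n) (range 2 (n ∸ 1))
SpikeP-length v n refl = refl

plusTest : ℕ → List ℕ → Bool
plusTest i u = Des (fl i u) i ⇔ᵇ Des u i

minusTest : ℕ → List ℕ → Bool
minusTest i u = Des (fl (i ∸ 1) u) (i ∸ 1) ⇔ᵇ Des u i

SpikeAt : List ℕ → ℕ → Set
SpikeAt u i = Des u (i ∸ 1) ≡ not (Des u i)

-- When the flip changes the descent it ought to preserve, i remains a spike.
module SpikeRemoval {u : List ℕ} (uu : Unique u) (i : ℕ) (2≤i : 2 ≤ i) (i< : i < length u)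
                    (spike : SpikeAt u i) where
  private
    n : ℕ
    n = length u
    R : List ℕ
    R = range 2 (n ∸ 1)
    i≤ : i ≤ n ∸ 1
    i≤ = ∸-monoˡ-≤ 1 i<
    i∸1≤ : i ∸ 1 ≤ n
    i∸1≤ = ≤-trans (m∸n≤m i 1) (<⇒≤ i<)
    i∈SpikeP : (i ∈ᵇ SpikeP u) ≡ true
    i∈SpikeP rewrite ∈ᵇ-filterᵇ i (isSpike (Des u) n) R | ∈ᵇ-range i n 2≤i i≤
      | isSpike-xor (Des u) n i | ≤ᵇ-true 2≤i | ≤ᵇ-true i≤ | spike = xor-inverseʳ (Des u i)
    spike-removed : ∀ v → length v ≡ n → (∀ k → Des v k ≡ toggleBelow i k (Des u k)) →
      spikeEq (SpikeP v) (remove i (SpikeP u)) ≡ true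
    spike-removed v len toggled rewrite SpikeP-length v n len | filterᵇ-filterᵇ (isSpike (Des u) n) (λ k → not (k ≡ᵇ i)) R
      | filterᵇ-cong {R = R} (All.tabulate {xs = R} λ {k} _ → isSpike-toggleBelow (Des v) (Des u) n i spike toggled k)
      = spikeEq-refl _
    spike-kept : ∀ v → length v ≡ n → Des v i xor Des v (i ∸ 1) ≡ true →
      spikeEq (SpikeP v) (remove i (SpikeP u)) ≡ false
    spike-kept v len e = spikeEq-≢ λ eq →
      true≢false (trans (sym i∈SpikeP-v) (trans (cong (i ∈ᵇ_) eq) (∈ᵇ-remove i (SpikeP u))))
      where
      i∈SpikeP-v : (i ∈ᵇ SpikeP v) ≡ true
      i∈SpikeP-v rewrite SpikeP-length v n len | ∈ᵇ-filterᵇ i (isSpike (Des v) n) R | ∈ᵇ-range i n 2≤i i≤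
        | isSpike-xor (Des v) n i | ≤ᵇ-true 2≤i | ≤ᵇ-true i≤ = e

  admitsPlus≡ : admitsPlus i u ≡ plusTest i u
  admitsPlus≡ rewrite i∈SpikeP with Des (fl i u) i Bool.≟ Des u i
  ... | yes same rewrite spike-removed (fl i u) (Flip.length-fl uu i (<⇒≤ i<)) (Des-fl-toggles uu i i< same) | same
    = sym (⇔ᵇ-refl (Des u i))
  ... | no differ = trans (spike-kept (fl i u) (Flip.length-fl uu i (<⇒≤ i<)) still-spike) (sym (≢⇒⇔ᵇ≡false differ))
    where
    below : Des (fl i u) (i ∸ 1) ≡ Des u i
    below = trans (subst (λ z → Des (fl i u) (z ∸ 1) ≡ not (Des u (z ∸ 1))) (m+[n∸m]≡n 2≤i)
                           (Flip.Des-fl-low uu i (<⇒≤ i<) (i ∸ 2) (subst (suc (i ∸ 2) <_) (m+[n∸m]≡n 2≤i) ≤-refl)))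
                  (trans (cong not spike) (not-involutive _))
    still-spike : Des (fl i u) i xor Des (fl i u) (i ∸ 1) ≡ true
    still-spike rewrite ¬-not differ | below = xor-inverseˡ (Des u i)

  admitsMinus≡ : admitsMinus i u ≡ minusTest i u
  admitsMinus≡ rewrite i∈SpikeP with Des (fl (i ∸ 1) u) (i ∸ 1) Bool.≟ Des u i
  ... | yes same rewrite spike-removed (fl (i ∸ 1) u) (Flip.length-fl uu (i ∸ 1) i∸1≤)
                           (Des-fl-pred-toggles uu i 2≤i i< (trans same (trans (sym (not-involutive _)) (cong not (sym spike)))))
                       | same
    = sym (⇔ᵇ-refl (Des u i))
  ... | no differ = trans (spike-kept (fl (i ∸ 1) u) (Flip.length-fl uu (i ∸ 1) i∸1≤) still-spike) (sym (≢⇒⇔ᵇ≡false differ))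
    where
    at-i : Des (fl (i ∸ 1) u) i ≡ Des u i
    at-i = Flip.Des-fl-high uu (i ∸ 1) i∸1≤ i (∸-monoʳ-< {i} {1} {0} (s≤s z≤n) (≤-trans (s≤s z≤n) 2≤i))
    still-spike : Des (fl (i ∸ 1) u) i xor Des (fl (i ∸ 1) u) (i ∸ 1) ≡ true
    still-spike rewrite ¬-not differ | at-i = xor-inverseʳ (Des u i)

Des-Ψ : ∀ {u} → Unique u → ∀ i → 2 ≤ i → i < length u → SpikeAt u i → AdmitsFlip i u →
  ∀ k → Des (Ψ i u) k ≡ toggleBelow i k (Des u k)
Des-Ψ {u} uu i 2≤i i< spike flip with admitsPlus i u in plus
... | true = Des-fl-toggles uu i i< (⇔ᵇ⇒≡ (trans (sym (SpikeRemoval.admitsPlus≡ uu i 2≤i i< spike)) plus))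
... | false with flip
...   | inj₂ minus = Des-fl-pred-toggles uu i 2≤i i<
  (trans (⇔ᵇ⇒≡ (trans (sym (SpikeRemoval.admitsMinus≡ uu i 2≤i i< spike)) (T⇒≡true minus)))
         (trans (sym (not-involutive _)) (cong not (sym spike))))

Ψ-↭ : ∀ {u} → Unique u → ∀ i → i ≤ length u → Ψ i u ↭ u
Ψ-↭ {u} uu i i≤ with admitsPlus i u
... | true = Flip.fl-↭ uu i i≤
... | false = Flip.fl-↭ uu (i ∸ 1) (≤-trans (m∸n≤m i 1) i≤)

take-Ψ-↭ : ∀ {u} → Unique u → ∀ i → i ≤ length u → ∀ m → i ≤ m → take m (Ψ i u) ↭ take m u
take-Ψ-↭ {u} uu i i≤ m i≤m with admitsPlus i u
... | true = Flip.take-fl-↭ uu i i≤ m i≤m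
... | false = Flip.take-fl-↭ uu (i ∸ 1) (≤-trans (m∸n≤m i 1) i≤) m (≤-trans (m∸n≤m i 1) i≤m)

-- Flipping the first i − 1 entries neither moves entries i and i + 1 nor changes the set of
-- the first i entries, so it cannot affect whether an i⁺-flip preserves the descent at i.
module AfterPredFlip {τ : List ℕ} (uτ : Unique τ) (i′ : ℕ) (i< : suc i′ < length τ) where
  private
    i : ℕ
    i = suc i′
    σ : List ℕ
    σ = fl i′ τ
    i′≤ : i′ ≤ length τ
    i′≤ = ≤-trans (n≤1+n i′) (<⇒≤ i<)
    open Flip uτ i′ i′≤ using (at-fl-high; Unique-fl; length-fl; take-fl-↭; Des-fl-high)
    i<σ : i < length σ
    i<σ = subst (i <_) (sym length-fl) i<
    same-last : at σ i ≡ at τ i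
    same-last = at-fl-high i′ ≤-refl
    same-next : at σ (suc i) ≡ at τ (suc i)
    same-next = at-fl-high i (n≤1+n i′)
    same-prefix : take i σ ↭ take i τ
    same-prefix = take-fl-↭ i (n≤1+n i′)

  Des-at : Des σ i ≡ Des τ i
  Des-at = Des-fl-high i ≤-refl

  Des-fl-at : Des (fl i σ) i ≡ Des (fl i τ) i
  Des-fl-at = trans (Boundary.Des-fl-boundary Unique-fl i′ i<σ) (trans
    (cong₂ (λ a b → a ≤ᵇ (i′ ∸ b)) (trans (rank-↭ _ same-prefix) (cong (rank (take i τ)) same-next))
                                  (trans (rank-↭ _ same-prefix) (cong (rank (take i τ)) same-last)))
    (sym (Boundary.Des-fl-boundary uτ i′ i<)))

  plusTest-fl : plusTest i σ ≡ plusTest i τ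
  plusTest-fl = cong₂ _⇔ᵇ_ Des-fl-at Des-at

≤ᵇ-∸ : ∀ x m q → q ≤ m → (x ≤ᵇ (m ∸ q)) ≡ ((x + q) ≤ᵇ m)
≤ᵇ-∸ x m q q≤m with ≤ᵇ-cases x (m ∸ q) | ≤ᵇ-cases (x + q) m
... | inj₁ (_ , e₁) | inj₁ (_ , e₂) rewrite e₁ | e₂ = refl
... | inj₂ (_ , e₁) | inj₂ (_ , e₂) rewrite e₁ | e₂ = refl
... | inj₁ (x≤ , _) | inj₂ (m< , _) = ⊥-elim (<⇒≱ m< (m≤o∸n⇒m+n≤o x q≤m x≤))
... | inj₂ (<x , _) | inj₁ (≤m , _) = ⊥-elim (<⇒≱ <x (m+n≤o⇒m≤o∸n x ≤m))

-- c, r, q are the ranks of entries i + 1, i, i − 1 among the first i (resp. i − 1) entries in Des-fl-pred-flips.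
≤ᵇ-no-spike : ∀ c r q m → (c ≤ᵇ r) ≡ (r ≤ᵇ q) → (c + r ≤ᵇ suc m) ≢ (c ≤ᵇ r) → (r + q ≤ᵇ m) ≡ not (r ≤ᵇ q)
≤ᵇ-no-spike c r q m same differ with ≤ᵇ-cases c r | ≤ᵇ-cases r q
... | inj₁ (_ , e₁) | inj₂ (_ , e₂) rewrite e₁ | e₂ = ⊥-elim (true≢false same)
... | inj₂ (_ , e₁) | inj₁ (_ , e₂) rewrite e₁ | e₂ = ⊥-elim (true≢false (sym same))
... | inj₁ (c≤r , e₁) | inj₁ (r≤q , e₂) rewrite e₁ | e₂ with ≤ᵇ-cases (c + r) (suc m)
...   | inj₁ (_ , e₃) = ⊥-elim (differ e₃)
...   | inj₂ (m< , _) =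
  ≤ᵇ-false (≤-trans (n≤1+n (suc m)) (≤-trans m< (≤-trans (+-monoˡ-≤ r (≤-trans c≤r r≤q)) (≤-reflexive (+-comm q r)))))
≤ᵇ-no-spike c r q m same differ | inj₂ (r<c , e₁) | inj₂ (q<r , e₂) rewrite e₁ | e₂ with ≤ᵇ-cases (c + r) (suc m)
...   | inj₂ (_ , e₃) = ⊥-elim (differ e₃)
...   | inj₁ (≤m , _) = ≤ᵇ-true (≤-trans (+-monoʳ-≤ r (<⇒≤ q<r)) (≤-pred (≤-trans (+-monoˡ-≤ r r<c) ≤m)))

-- Where there is no spike at i and an i⁺-flip would change the descent at i, an i⁻-flip
-- changes the descent at i − 1: this is what makes every non-spike reachable.
Des-fl-pred-flips : ∀ {τ} → Unique τ → ∀ m → suc (suc m) < length τ → Des τ (suc m) ≡ Des τ (suc (suc m)) →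
  Des (fl (suc (suc m)) τ) (suc (suc m)) ≢ Des τ (suc (suc m)) → Des (fl (suc m) τ) (suc m) ≡ not (Des τ (suc m))
Des-fl-pred-flips {τ} uτ m i< no-spike differ = begin
  Des (fl (suc m) τ) (suc m) ≡⟨ Boundary.Des-fl-boundary uτ m i-1< ⟩
  (r ≤ᵇ (m ∸ q))             ≡⟨ ≤ᵇ-∸ r m q q≤m ⟩
  (r + q ≤ᵇ m)               ≡⟨ ≤ᵇ-no-spike c r q m (trans (sym Des-i) (trans (sym no-spike) Des-i-1))
                                  (λ e → differ (trans Des-fl-i (trans e (sym Des-i)))) ⟩
  not (r ≤ᵇ q)               ≡⟨ cong not (sym Des-i-1) ⟩
  not (Des τ (suc m)) ∎
  where
  open ≡-Reasoning
  i : ℕ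
  i = suc (suc m)
  P : List ℕ
  P = take i τ
  Q : List ℕ
  Q = take (suc m) τ
  i-1< : suc m < length τ
  i-1< = <-trans (n<1+n (suc m)) i<
  y : ℕ
  y = at τ i
  rank-P≡rank-Q : rank P y ≡ rank Q y
  rank-P≡rank-Q = begin
    rank P y                 ≡⟨ cong (λ z → rank z y) (take-snoc (suc m) τ i-1<) ⟩
    rank (Q ++ [ y ]) y      ≡⟨ rank-++ Q [ y ] y ⟩
    rank Q y + rank [ y ] y  ≡⟨ cong (rank Q y +_) (rank-singleton-self y) ⟩
    rank Q y + 0             ≡⟨ +-identityʳ _ ⟩
    rank Q y ∎
  c : ℕ
  c = rank P (at τ (suc i))
  r : ℕ
  r = rank Q y
  q : ℕ
  q = rank Q (at τ (suc m))
  length-Q : length Q ≡ suc m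
  length-Q = length-take-≤ (suc m) τ (<⇒≤ i-1<)
  q≤m : q ≤ m
  q≤m = ≤-pred (subst (q <_) length-Q (rank<length (Flip.at∈P uτ (suc m) (<⇒≤ i-1<) m ≤-refl)))
  r≤ : r ≤ suc m
  r≤ = subst (r ≤_) length-Q (rank≤length Q y)
  Des-i : Des τ i ≡ (c ≤ᵇ r)
  Des-i = trans (Boundary.Des-boundary uτ (suc m) i<) (cong (c ≤ᵇ_) rank-P≡rank-Q)
  Des-fl-i : Des (fl i τ) i ≡ (c + r ≤ᵇ suc m)
  Des-fl-i = trans (Boundary.Des-fl-boundary uτ (suc m) i<)
    (trans (cong (λ z → c ≤ᵇ (suc m ∸ z)) rank-P≡rank-Q) (≤ᵇ-∸ c (suc m) r r≤))
  Des-i-1 : Des τ (suc m) ≡ (r ≤ᵇ q)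
  Des-i-1 = Boundary.Des-boundary uτ m i-1<

toggleBelow-creates-spike : ∀ {σ τ} i → 2 ≤ i → (∀ k → Des σ k ≡ toggleBelow i k (Des τ k)) →
  Des τ (i ∸ 1) ≡ Des τ i → SpikeAt σ i × Des σ i ≡ Des τ i
toggleBelow-creates-spike {σ} {τ} (suc (suc m)) (s≤s (s≤s z≤n)) toggled no-spike = spike , Des-i
  where
  Des-i : Des σ (suc (suc m)) ≡ Des τ (suc (suc m))
  Des-i = trans (toggled (suc (suc m))) (toggleBelow-high {suc (suc m)} {suc (suc m)} (Des τ (suc (suc m))) ≤-refl)
  spike : SpikeAt σ (suc (suc m))
  spike = trans (toggled (suc m))
    (trans (toggleBelow-low {suc (suc m)} {suc m} (Des τ (suc m)) (s≤s z≤n) ≤-refl) (cong not (trans no-spike (sym Des-i))))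

-- A spike cannot be removed by an i⁺-flip from one permutation and by an i⁻-flip from
-- another with the same result: the i⁺-test is invariant under the (i−1)-flip.
Ψ-branches-differ : ∀ {u u′} → Unique u → Unique u′ → ∀ i → 2 ≤ i → i < length u → i < length u′ →
  SpikeAt u i → SpikeAt u′ i → admitsPlus i u ≡ true → admitsPlus i u′ ≡ false → fl i u ≢ fl (i ∸ 1) u′
Ψ-branches-differ {u} {u′} uu uu′ i@(suc i′) 2≤i i<u i<u′ spike spike′ plus plus′ e = true≢false (begin
  true                              ≡⟨ sym plus ⟩
  admitsPlus i u                    ≡⟨ SpikeRemoval.admitsPlus≡ uu i 2≤i i<u spike ⟩
  (Des (fl i u) i ⇔ᵇ Des u i)       ≡⟨ ⇔ᵇ-sym (Des (fl i u) i) (Des u i) ⟩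
  (Des u i ⇔ᵇ Des (fl i u) i)       ≡⟨ cong₂ (λ a b → Des a i ⇔ᵇ Des b i) u≡fl-τ e ⟩
  (Des (fl i τ) i ⇔ᵇ Des τ i)       ≡⟨ AfterPredFlip.plusTest-fl uu′ i′ i<u′ ⟩
  (Des (fl i u′) i ⇔ᵇ Des u′ i)     ≡⟨ sym (SpikeRemoval.admitsPlus≡ uu′ i 2≤i i<u′ spike′) ⟩
  admitsPlus i u′                   ≡⟨ plus′ ⟩
  false ∎)
  where
  open ≡-Reasoning
  τ : List ℕ
  τ = fl i′ u′
  u≡fl-τ : u ≡ fl i τ
  u≡fl-τ = trans (sym (Flip.fl-involutive uu i (<⇒≤ i<u))) (cong (fl i) e)

fl-injective : ∀ {u u′} → Unique u → Unique u′ → ∀ L → L ≤ length u → L ≤ length u′ → fl L u ≡ fl L u′ → u ≡ u′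
fl-injective uu uu′ L L≤u L≤u′ e =
  trans (sym (Flip.fl-involutive uu L L≤u)) (trans (cong (fl L) e) (Flip.fl-involutive uu′ L L≤u′))

Ψ-injective : ∀ {u u′} → Unique u → Unique u′ → ∀ i → 2 ≤ i → i < length u → i < length u′ →
  SpikeAt u i → SpikeAt u′ i → Ψ i u ≡ Ψ i u′ → u ≡ u′
Ψ-injective {u} {u′} uu uu′ i 2≤i i<u i<u′ spike spike′ e with admitsPlus i u in plus | admitsPlus i u′ in plus′
... | true | true = fl-injective uu uu′ i (<⇒≤ i<u) (<⇒≤ i<u′) e
... | false | false = fl-injective uu uu′ (i ∸ 1) (≤-trans (m∸n≤m i 1) (<⇒≤ i<u)) (≤-trans (m∸n≤m i 1) (<⇒≤ i<u′)) e
... | true | false = ⊥-elim (Ψ-branches-differ uu uu′ i 2≤i i<u i<u′ spike spike′ plus plus′ e)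
... | false | true = ⊥-elim (Ψ-branches-differ uu′ uu i 2≤i i<u′ i<u spike′ spike plus′ plus (sym e))

Ψ-Preimage : List ℕ → ℕ → Set
Ψ-Preimage τ i = ∃ λ σ → σ ↭ τ × (∀ k → Des σ k ≡ toggleBelow i k (Des τ k)) × AdmitsFlip i σ × Ψ i σ ≡ τ

Ψ-preimage-plus : ∀ {τ} → Unique τ → ∀ i → 2 ≤ i → i < length τ → Des τ (i ∸ 1) ≡ Des τ i →
  Des (fl i τ) i ≡ Des τ i → Ψ-Preimage τ i
Ψ-preimage-plus {τ} uτ i 2≤i i< no-spike same =
  σ , Flip.fl-↭ uτ i (<⇒≤ i<) , toggled , inj₁ (subst T (sym plus) tt) , Ψσ≡τ
  where
  σ : List ℕ
  σ = fl i τ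
  toggled : ∀ k → Des σ k ≡ toggleBelow i k (Des τ k)
  toggled = Des-fl-toggles uτ i i< same
  uσ : Unique σ
  uσ = Flip.Unique-fl uτ i (<⇒≤ i<)
  i<σ : i < length σ
  i<σ = subst (i <_) (sym (Flip.length-fl uτ i (<⇒≤ i<))) i<
  σ-spike : SpikeAt σ i × Des σ i ≡ Des τ i
  σ-spike = toggleBelow-creates-spike {σ} {τ} i 2≤i toggled no-spike
  plus : admitsPlus i σ ≡ true
  plus = trans (SpikeRemoval.admitsPlus≡ uσ i 2≤i i<σ (proj₁ σ-spike))
    (trans (cong₂ _⇔ᵇ_ (cong (λ z → Des z i) (Flip.fl-involutive uτ i (<⇒≤ i<))) (proj₂ σ-spike)) (⇔ᵇ-refl (Des τ i)))
  Ψσ≡τ : Ψ i σ ≡ τ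
  Ψσ≡τ rewrite plus = Flip.fl-involutive uτ i (<⇒≤ i<)

Ψ-preimage-minus : ∀ {τ} → Unique τ → ∀ i → 2 ≤ i → i < length τ → Des τ (i ∸ 1) ≡ Des τ i →
  Des (fl i τ) i ≢ Des τ i → Ψ-Preimage τ i
Ψ-preimage-minus {τ} uτ i@(suc (suc m)) 2≤i@(s≤s (s≤s z≤n)) i< no-spike differ =
  σ , Flip.fl-↭ uτ (suc m) i-1≤ , toggled , inj₂ (subst T (sym minus) tt) , Ψσ≡τ
  where
  i-1≤ : suc m ≤ length τ
  i-1≤ = ≤-trans (n≤1+n (suc m)) (<⇒≤ i<)
  σ : List ℕ
  σ = fl (suc m) τ
  toggled : ∀ k → Des σ k ≡ toggleBelow i k (Des τ k)
  toggled = Des-fl-pred-toggles uτ i 2≤i i< (Des-fl-pred-flips uτ m i< no-spike differ)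
  uσ : Unique σ
  uσ = Flip.Unique-fl uτ (suc m) i-1≤
  i<σ : i < length σ
  i<σ = subst (i <_) (sym (Flip.length-fl uτ (suc m) i-1≤)) i<
  σ-spike : SpikeAt σ i × Des σ i ≡ Des τ i
  σ-spike = toggleBelow-creates-spike {σ} {τ} i 2≤i toggled no-spike
  minus : admitsMinus i σ ≡ true
  minus = trans (SpikeRemoval.admitsMinus≡ uσ i 2≤i i<σ (proj₁ σ-spike))
    (trans (cong₂ _⇔ᵇ_ (cong (λ z → Des z (suc m)) (Flip.fl-involutive uτ (suc m) i-1≤)) (proj₂ σ-spike))
      (trans (cong (_⇔ᵇ Des τ i) no-spike) (⇔ᵇ-refl (Des τ i))))
  plus : admitsPlus i σ ≡ false
  plus = trans (SpikeRemoval.admitsPlus≡ uσ i 2≤i i<σ (proj₁ σ-spike))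
    (trans (AfterPredFlip.plusTest-fl uτ (suc m) i<) (≢⇒⇔ᵇ≡false differ))
  Ψσ≡τ : Ψ i σ ≡ τ
  Ψσ≡τ rewrite plus = Flip.fl-involutive uτ (suc m) i-1≤

Ψ-surjective : ∀ {τ} → Unique τ → ∀ i → 2 ≤ i → i < length τ → Des τ (i ∸ 1) ≡ Des τ i → Ψ-Preimage τ i
Ψ-surjective {τ} uτ i 2≤i i< no-spike with Des (fl i τ) i Bool.≟ Des τ i
... | yes same = Ψ-preimage-plus uτ i 2≤i i< no-spike same
... | no differ = Ψ-preimage-minus uτ i 2≤i i< no-spike differ

parityAbove : List ℕ → ℕ → Bool
parityAbove [] k = false
parityAbove (x ∷ xs) k = (k <ᵇ x) xor parityAbove xs k

Sᵖ : List ℕ → ℕ → Bool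
Sᵖ K k = (1 ≤ᵇ k) ∧ parityAbove K k

parityAbove-++ : ∀ xs ys k → parityAbove (xs ++ ys) k ≡ (parityAbove xs k xor parityAbove ys k)
parityAbove-++ [] ys k = refl
parityAbove-++ (x ∷ xs) ys k rewrite parityAbove-++ xs ys k = sym (xor-assoc (k <ᵇ x) (parityAbove xs k) (parityAbove ys k))

parityAbove-reverse : ∀ xs k → parityAbove (reverse xs) k ≡ parityAbove xs k
parityAbove-reverse [] k = refl
parityAbove-reverse (x ∷ xs) k rewrite unfold-reverse x xs | parityAbove-++ (reverse xs) [ x ] k
  | parityAbove-reverse xs k | xor-identityʳ (k <ᵇ x) = xor-comm (parityAbove xs k) (k <ᵇ x)

parityAbove-low : ∀ {k xs} → All (_≤ k) xs → parityAbove xs k ≡ false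
parityAbove-low [] = refl
parityAbove-low {k} (x≤k ∷ a) rewrite <ᵇ-false x≤k = parityAbove-low a

AllPairs-reverse : ∀ {R : ℕ → ℕ → Set} {xs} → AllPairs R xs → AllPairs (λ a b → R b a) (reverse xs)
AllPairs-reverse {xs = []} [] = []
AllPairs-reverse {xs = x ∷ xs} (a ∷ p) rewrite unfold-reverse x xs =
  AllPairs.++⁺ (AllPairs-reverse p) ([] ∷ [])
    (All.map (λ r → r ∷ []) (All-resp-↭ (↭-sym (↭-reverse xs)) a))

SKrev-low : ∀ {k r} → All (_≤ k) r → SKrev r k ≡ false
SKrev-low [] = refl
SKrev-low (_ ∷ []) = refl
SKrev-low {k} {a ∷ b ∷ rest} (a≤k ∷ _ ∷ ps) rewrite <ᵇ-false a≤k | ∧-zeroʳ (b ≤ᵇ k) = SKrev-low ps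

SKrev-zero : ∀ {r} → All (1 ≤_) r → SKrev r 0 ≡ false
SKrev-zero [] = refl
SKrev-zero (_ ∷ []) = refl
SKrev-zero {a ∷ suc b ∷ r} (_ ∷ _ ∷ ps) = SKrev-zero ps

-- Going down the boundaries r₀ > r₁ > …, x lies in the union of the intervals [r_{2t+1}, r_{2t})
-- exactly when an odd number of boundaries exceed x.
SKrev≡parityAbove : ∀ {x r} → AllPairs (λ p q → q < p) r → Any (_≤ x) r → SKrev r x ≡ parityAbove r x
SKrev≡parityAbove {x} {a ∷ []} _ (here a≤x) rewrite <ᵇ-false a≤x = refl
SKrev≡parityAbove {x} {a ∷ b ∷ rest} ((b<a ∷ _) ∷ (rest<b ∷ ap)) below with <ᵇ-cases x b
... | inj₁ (x<b , e) rewrite e | ≤ᵇ-false x<b | <ᵇ-true (<-trans x<b b<a) =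
  trans (SKrev≡parityAbove ap (below-rest below)) (sym (not-involutive _))
  where
  below-rest : Any (_≤ x) (a ∷ b ∷ rest) → Any (_≤ x) rest
  below-rest (here a≤x) = ⊥-elim (<⇒≱ (<-trans x<b b<a) a≤x)
  below-rest (there (here b≤x)) = ⊥-elim (<⇒≱ x<b b≤x)
  below-rest (there (there r≤x)) = r≤x
... | inj₂ (b≤x , e) with <ᵇ-cases x a | All.map (λ r<b → <⇒≤ (<-≤-trans r<b b≤x)) rest<b
...   | inj₁ (_ , e₂) | rest≤x rewrite ≤ᵇ-true b≤x | e | e₂ | parityAbove-low rest≤x = refl
...   | inj₂ (_ , e₂) | rest≤x rewrite ≤ᵇ-true b≤x | e | e₂ | parityAbove-low rest≤x = SKrev-low rest≤x

S≡Sᵖ : ∀ {K} → AllPairs _<_ K → All (2 ≤_) K → ∀ k → S_ K k ≡ Sᵖ K k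
S≡Sᵖ {K} _ 2≤K zero = SKrev-zero (All-resp-↭ (↭-sym (↭-reverse (1 ∷ K))) (s≤s z≤n ∷ All.map (≤-trans (n≤1+n 1)) 2≤K))
S≡Sᵖ {K} ap 2≤K (suc k) =
  trans (SKrev≡parityAbove (AllPairs-reverse (2≤K ∷ ap)) (Any.reverse⁺ {xs = 1 ∷ K} (here (s≤s z≤n))))
        (parityAbove-reverse (1 ∷ K) (suc k))

∖-[] : ∀ I → I ∖ [] ≡ I
∖-[] [] = refl
∖-[] (x ∷ I) = cong (x ∷_) (∖-[] I)

∈ᵇ-false : ∀ {j js} → All (j <_) js → (j ∈ᵇ js) ≡ false
∈ᵇ-false [] = refl
∈ᵇ-false {j} {y ∷ ys} (j<y ∷ a) rewrite ≡ᵇ-false (<⇒≢ j<y) = ∈ᵇ-false a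

∉-∖-∷ : ∀ I j js → All (_≢ j) (I ∖ (j ∷ js))
∉-∖-∷ I j js = All.map (λ {y} t y≡j → absurd y≡j t) (All.all-filter (T? ∘ λ k → not (k ∈ᵇ (j ∷ js))) I)
  where
  absurd : ∀ {y} → y ≡ j → ¬ T (not (y ∈ᵇ (j ∷ js)))
  absurd {y} refl t rewrite ≡ᵇ-refl y = t

∈-∖ : ∀ {I j js} → j ∈ I → (j ∈ᵇ js) ≡ false → j ∈ I ∖ js
∈-∖ {js = js} j∈I j∉js = ∈-filter⁺ (T? ∘ λ k → not (k ∈ᵇ js)) j∈I (subst T (sym (cong not j∉js)) tt)

AllPairs-∖ : ∀ {R : ℕ → ℕ → Set} {I} js → AllPairs R I → AllPairs R (I ∖ js)
AllPairs-∖ js = AllPairs.filter⁺ (T? ∘ λ k → not (k ∈ᵇ js))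

All-∖ : ∀ {P : ℕ → Set} {I} js → All P I → All P (I ∖ js)
All-∖ js = All.filter⁺ (T? ∘ λ k → not (k ∈ᵇ js))

AllPairs-resp-⊆ : ∀ {R : ℕ → ℕ → Set} {xs ys} → xs ⊆ ys → AllPairs R ys → AllPairs R xs
AllPairs-resp-⊆ [] a = a
AllPairs-resp-⊆ (_ ∷ʳ p) (_ ∷ a) = AllPairs-resp-⊆ p a
AllPairs-resp-⊆ (refl ∷ p) (r ∷ a) = All-resp-⊆ p r ∷ AllPairs-resp-⊆ p a

≤maxL : ∀ {x I} → x ∈ I → x ≤ maxL I
≤maxL {x} {y ∷ I} (here refl) = m≤m⊔n x (maxL I)
≤maxL {x} {y ∷ I} (there x∈) = ≤-trans (≤maxL x∈) (m≤n⊔m y (maxL I))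

<ᵇ-pred : ∀ {y j} → y ≢ j → 1 ≤ j → ((j ∸ 1) <ᵇ y) ≡ (j <ᵇ y)
<ᵇ-pred {y} {suc j} y≢j _ with <-cmp j y
... | tri< j<y _ _ with m≤n⇒m<n∨m≡n j<y
...   | inj₁ sj<y rewrite <ᵇ-true j<y | <ᵇ-true sj<y = refl
...   | inj₂ sj≡y = ⊥-elim (y≢j (sym sj≡y))
<ᵇ-pred {y} {suc j} _ _ | tri≈ _ refl _ rewrite <ᵇ-false {y} {y} ≤-refl | <ᵇ-false {suc y} {y} (n≤1+n y) = refl
<ᵇ-pred {y} {suc j} _ _ | tri> _ _ y<j rewrite <ᵇ-false (<⇒≤ y<j) | <ᵇ-false {suc j} {y} (≤-trans (<⇒≤ y<j) (n≤1+n j)) = refl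

parityAbove-pred-∉ : ∀ {K j} → All (_≢ j) K → 1 ≤ j → parityAbove K (j ∸ 1) ≡ parityAbove K j
parityAbove-pred-∉ [] _ = refl
parityAbove-pred-∉ {y ∷ K} (y≢j ∷ a) 1≤j rewrite <ᵇ-pred y≢j 1≤j | parityAbove-pred-∉ a 1≤j = refl

parityAbove-pred-∈ : ∀ {K j} → AllPairs _<_ K → j ∈ K → 1 ≤ j → parityAbove K (j ∸ 1) ≡ not (parityAbove K j)
parityAbove-pred-∈ {x ∷ K} {j} (j< ∷ _) (here refl) 1≤j
  rewrite parityAbove-pred-∉ (All.map (λ j<y y≡j → <⇒≢ j<y (sym y≡j)) j<) 1≤j
        | <ᵇ-false {j} {j} ≤-refl | <ᵇ-true {j ∸ 1} {j} (∸-monoʳ-< {j} {1} {0} (s≤s z≤n) 1≤j) = refl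
parityAbove-pred-∈ {x ∷ K} {j} (x< ∷ ap) (there j∈) 1≤j
  rewrite <ᵇ-pred {x} {j} (<⇒≢ (All.lookup x< j∈)) 1≤j | parityAbove-pred-∈ ap j∈ 1≤j with j <ᵇ x
... | true = refl
... | false = refl

Sᵖ-spike : ∀ {K j} → AllPairs _<_ K → j ∈ K → 2 ≤ j → Sᵖ K (j ∸ 1) ≡ not (Sᵖ K j)
Sᵖ-spike {j = suc (suc _)} ap j∈ (s≤s (s≤s z≤n)) = parityAbove-pred-∈ ap j∈ (s≤s z≤n)

Sᵖ-no-spike : ∀ {K j} → All (_≢ j) K → 2 ≤ j → Sᵖ K (j ∸ 1) ≡ Sᵖ K j
Sᵖ-no-spike {j = suc (suc _)} a (s≤s (s≤s z≤n)) = parityAbove-pred-∉ a (s≤s z≤n)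

parityAbove-∖ : ∀ {I j js} → AllPairs _<_ I → j ∈ I → (j ∈ᵇ js) ≡ false → ∀ k →
  parityAbove (I ∖ js) k ≡ ((k <ᵇ j) xor parityAbove (I ∖ (j ∷ js)) k)
parityAbove-∖ {x ∷ I} {j} {js} (j< ∷ _) (here refl) j∉js k rewrite j∉js | ≡ᵇ-refl j =
  cong ((k <ᵇ j) xor_) (cong (λ z → parityAbove z k) (filterᵇ-cong (All.map same-test j<)))
  where
  same-test : ∀ {y} → j < y → not (y ∈ᵇ js) ≡ not (y ∈ᵇ (j ∷ js))
  same-test j<y rewrite ≡ᵇ-false (>⇒≢ j<y) = refl
parityAbove-∖ {x ∷ I} {j} {js} (x< ∷ ap) (there j∈) j∉js k rewrite ≡ᵇ-false (<⇒≢ (All.lookup x< j∈)) with x ∈ᵇ js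
... | true = parityAbove-∖ {js = js} ap j∈ j∉js k
... | false = trans (cong ((k <ᵇ x) xor_) (parityAbove-∖ {js = js} ap j∈ j∉js k)) (xor-swap (k <ᵇ x) (k <ᵇ j) _)
  where
  xor-swap : ∀ a b c → (a xor (b xor c)) ≡ (b xor (a xor c))
  xor-swap a b c = trans (sym (xor-assoc a b c)) (trans (cong (_xor c) (xor-comm a b)) (xor-assoc b a c))

Sᵖ-∖ : ∀ {I j js} → AllPairs _<_ I → j ∈ I → (j ∈ᵇ js) ≡ false → ∀ k →
  Sᵖ (I ∖ js) k ≡ toggleBelow j k (Sᵖ (I ∖ (j ∷ js)) k)
Sᵖ-∖ _ _ _ zero = refl
Sᵖ-∖ {js = js} ap j∈ j∉js (suc k) = parityAbove-∖ {js = js} ap j∈ j∉js (suc k)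

Sᵖ-∖-∷ : ∀ {I j js} → AllPairs _<_ I → j ∈ I → (j ∈ᵇ js) ≡ false → ∀ k →
  Sᵖ (I ∖ (j ∷ js)) k ≡ toggleBelow j k (Sᵖ (I ∖ js) k)
Sᵖ-∖-∷ {I} {j} {js} ap j∈ j∉js k =
  trans (sym (toggleBelow-involutive j k _)) (cong (toggleBelow j k) (sym (Sᵖ-∖ {js = js} ap j∈ j∉js k)))

-- A flip at L > j complements the first j + 1 entries, which negates both sides of each test at j.
tests-fl : ∀ {w} → Unique w → ∀ j → 2 ≤ j → ∀ L → suc j ≤ L → L ≤ length w →
  plusTest j (fl L w) ≡ plusTest j w × minusTest j (fl L w) ≡ minusTest j w
tests-fl {w} uw j@(suc (suc j′)) (s≤s (s≤s z≤n)) L j<L L≤ =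
  trans (cong₂ _⇔ᵇ_ (Des-fl-after-fl uw L L≤ (suc j′) j<L) Des-j) (⇔ᵇ-not (Des (fl j w) j) (Des w j)) ,
  trans (cong₂ _⇔ᵇ_ (Des-fl-after-fl uw L L≤ j′ (<-trans (n<1+n (suc j′)) j<L)) Des-j)
        (⇔ᵇ-not (Des (fl (suc j′) w) (suc j′)) (Des w j))
  where
  Des-j : Des (fl L w) j ≡ not (Des w j)
  Des-j = Flip.Des-fl-low uw L L≤ (suc j′) j<L

tests-Ψ : ∀ {w} → Unique w → ∀ j → 2 ≤ j → ∀ b → suc j < b → b ≤ length w →
  plusTest j (Ψ b w) ≡ plusTest j w × minusTest j (Ψ b w) ≡ minusTest j w
tests-Ψ {w} uw j 2≤j b j<b b≤ with admitsPlus b w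
... | true = tests-fl uw j 2≤j b (<⇒≤ j<b) b≤
... | false = tests-fl uw j 2≤j (b ∸ 1) (∸-monoˡ-≤ 1 j<b) (≤-trans (m∸n≤m b 1) b≤)

ΨJ-↭-tests : ∀ {u} → Unique u → ∀ j → 2 ≤ j → ∀ js → All (λ b → suc j < b × b ≤ length u) js →
  ΨJ js u ↭ u × plusTest j (ΨJ js u) ≡ plusTest j u × minusTest j (ΨJ js u) ≡ minusTest j u
ΨJ-↭-tests uu j 2≤j [] _ = ↭-refl , refl , refl
ΨJ-↭-tests {u} uu j 2≤j (b ∷ js) ((j<b , b≤) ∷ bounds) with ΨJ-↭-tests uu j 2≤j js bounds
... | w↭u , plus , minus = ↭-trans (Ψ-↭ uw b b≤w) w↭u , trans (proj₁ step) plus , trans (proj₂ step) minus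
  where
  uw : Unique (ΨJ js u)
  uw = Unique-resp-↭ (↭-sym w↭u) uu
  b≤w : b ≤ length (ΨJ js u)
  b≤w = ≤-trans b≤ (≤-reflexive (sym (↭-length w↭u)))
  step : plusTest j (Ψ b (ΨJ js u)) ≡ plusTest j (ΨJ js u) × minusTest j (Ψ b (ΨJ js u)) ≡ minusTest j (ΨJ js u)
  step = tests-Ψ uw j 2≤j b j<b b≤w

AdmitsFlip-transfer : ∀ {u v} → Unique u → Unique v → ∀ j → 2 ≤ j → j < length u → j < length v →
  SpikeAt u j → SpikeAt v j → plusTest j v ≡ plusTest j u → minusTest j v ≡ minusTest j u →
  AdmitsFlip j u → AdmitsFlip j v
AdmitsFlip-transfer uu uv j 2≤j j<u j<v spike-u spike-v plus minus = Sum.map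
  (subst T (sym (trans (SpikeRemoval.admitsPlus≡ uv j 2≤j j<v spike-v)
                       (trans plus (sym (SpikeRemoval.admitsPlus≡ uu j 2≤j j<u spike-u))))))
  (subst T (sym (trans (SpikeRemoval.admitsMinus≡ uv j 2≤j j<v spike-v)
                       (trans minus (sym (SpikeRemoval.admitsMinus≡ uu j 2≤j j<u spike-u))))))

length-range : ∀ n → length (range 1 n) ≡ n
length-range n = trans (length-map (1 +_) (upTo n)) (length-upTo n)

IsPerm⇒length : ∀ {n σ} → IsPerm n σ → length σ ≡ n
IsPerm⇒length {n} p = trans (↭-length p) (length-range n)

IsPerm⇒Unique : ∀ {n σ} → IsPerm n σ → Unique σ
IsPerm⇒Unique {n} p = Unique-resp-↭ (↭-sym p) (Unique.map⁺ suc-injective (Unique.upTo⁺ n))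

take-ΨJ-↭ : ∀ {σ} → Unique σ → ∀ m J → All (λ j → j ≤ m × j ≤ length σ) J → ΨJ J σ ↭ σ × take m (ΨJ J σ) ↭ take m σ
take-ΨJ-↭ uσ m [] _ = ↭-refl , ↭-refl
take-ΨJ-↭ {σ} uσ m (j ∷ js) ((j≤m , j≤) ∷ bounds) with take-ΨJ-↭ uσ m js bounds
... | w↭σ , take-w↭ = ↭-trans (Ψ-↭ uw j j≤w) w↭σ , ↭-trans (take-Ψ-↭ uw j j≤w m j≤m) take-w↭
  where
  uw : Unique (ΨJ js σ)
  uw = Unique-resp-↭ (↭-sym w↭σ) uσ
  j≤w : j ≤ length (ΨJ js σ)
  j≤w = ≤-trans j≤ (≤-reflexive (sym (↭-length w↭σ)))

∈ᵇ-resp-↭ : ∀ {xs ys} x → xs ↭ ys → (x ∈ᵇ xs) ≡ (x ∈ᵇ ys)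
∈ᵇ-resp-↭ x ↭-refl = refl
∈ᵇ-resp-↭ x (prep y p) = cong ((x ≡ᵇ y) ∨_) (∈ᵇ-resp-↭ x p)
∈ᵇ-resp-↭ x (swap a b p) =
  trans (cong (λ r → (x ≡ᵇ a) ∨ ((x ≡ᵇ b) ∨ r)) (∈ᵇ-resp-↭ x p)) (∨-swap (x ≡ᵇ a) (x ≡ᵇ b) _)
  where
  ∨-swap : ∀ a b c → (a ∨ (b ∨ c)) ≡ (b ∨ (a ∨ c))
  ∨-swap true b c = sym (∨-zeroʳ b)
  ∨-swap false b c = refl
∈ᵇ-resp-↭ x (↭-trans p q) = trans (∈ᵇ-resp-↭ x p) (∈ᵇ-resp-↭ x q)

WindowIs-resp-↭ : ∀ {σ τ} m k → take m σ ↭ take m τ → WindowIs m k σ → WindowIs m k τ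
WindowIs-resp-↭ {σ} {τ} m k p w x =
  trans (cong (λ b → b ∧ ((suc m ≤ᵇ x) ∧ (x ≤ᵇ m + m))) (∈ᵇ-resp-↭ x (↭-sym p))) (w x)

module Bijection (n : ℕ) (I : List ℕ) (I-admissible : AllPairs (λ a b → suc a < b) I)
                 (I-bounds : All (λ i → 2 ≤ i × i ≤ n ∸ 1) I) where

  Dᵖ : List ℕ → List ℕ → Set
  Dᵖ K σ = IsPerm n σ × (∀ k → Des σ k ≡ Sᵖ K k)

  Admits : List ℕ → List ℕ → Set
  Admits J σ = All (λ j → AdmitsFlip j σ) J

  MapsInto InjectiveOn SurjectiveOnto Bijective : List ℕ → Set
  MapsInto J = ∀ σ → Dᵖ I σ → Admits J σ → Dᵖ (I ∖ J) (ΨJ J σ)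
  InjectiveOn J = ∀ σ τ → Dᵖ I σ → Admits J σ → Dᵖ I τ → Admits J τ → ΨJ J σ ≡ ΨJ J τ → σ ≡ τ
  SurjectiveOnto J = ∀ τ → Dᵖ (I ∖ J) τ → ∃ λ σ → Dᵖ I σ × Admits J σ × ΨJ J σ ≡ τ
  Bijective J = MapsInto J × InjectiveOn J × SurjectiveOnto J

  I-strict : AllPairs _<_ I
  I-strict = AllPairs.map (<-trans (n<1+n _)) I-admissible

  Dᵖ-spike : ∀ {K ρ j} → AllPairs _<_ K → j ∈ K → 2 ≤ j → Dᵖ K ρ → SpikeAt ρ j
  Dᵖ-spike {j = j} K-strict j∈K 2≤j (_ , d) = trans (d (j ∸ 1)) (trans (Sᵖ-spike K-strict j∈K 2≤j) (cong not (sym (d j))))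

  <-length : ∀ {σ i} → IsPerm n σ → i ∈ I → i < length σ
  <-length {σ} {i} p i∈I = subst (i <_) (sym (IsPerm⇒length p)) (≤-trans (s≤s i≤) (≤-reflexive (m+[n∸m]≡n 1≤n)))
    where
    i≤ : i ≤ n ∸ 1
    i≤ = proj₂ (All.lookup I-bounds i∈I)
    1≤n : 1 ≤ n
    1≤n = ≤-trans (s≤s z≤n) (≤-trans (proj₁ (All.lookup I-bounds i∈I)) (≤-trans i≤ (m∸n≤m n 1)))

  Bijective-[] : Bijective []
  Bijective-[] = (λ σ (p , d) _ → p , λ k → trans (d k) (cong (λ K → Sᵖ K k) (sym (∖-[] I))))
               , (λ _ _ _ _ _ _ e → e)
               , (λ τ (p , d) → τ , (p , λ k → trans (d k) (cong (λ K → Sᵖ K k) (∖-[] I))) , [] , refl)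

  module Step (j : ℕ) (js : List ℕ) (j∷js⊆I : (j ∷ js) ⊆ I) (j<js : All (λ b → suc j < b) js)
              (ih : Bijective js) where
    private
      j∈I : j ∈ I
      j∈I = Any-resp-⊆ j∷js⊆I (here refl)
      2≤j : 2 ≤ j
      2≤j = proj₁ (All.lookup I-bounds j∈I)
      j∉js : (j ∈ᵇ js) ≡ false
      j∉js = ∈ᵇ-false (All.map (<-trans (n<1+n j)) j<js)
      K : List ℕ
      K = I ∖ js
      ih-maps : MapsInto js
      ih-maps = proj₁ ih
      ih-injective : InjectiveOn js
      ih-injective = proj₁ (proj₂ ih)
      ih-surjective : SurjectiveOnto js
      ih-surjective = proj₂ (proj₂ ih)

      spike-K : ∀ {ρ} → Dᵖ K ρ → SpikeAt ρ j
      spike-K = Dᵖ-spike (AllPairs-∖ js I-strict) (∈-∖ {js = js} j∈I j∉js) 2≤j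

      AdmitsFlip-ΨJ : ∀ {σ} → Dᵖ I σ → Admits js σ → AdmitsFlip j σ ⇔ AdmitsFlip j (ΨJ js σ)
      AdmitsFlip-ΨJ {σ} dσ@(p , _) as = mk⇔
        (AdmitsFlip-transfer uσ uρ j 2≤j (<-length p j∈I) (<-length pρ j∈I) spike-σ spike-ρ plus minus)
        (AdmitsFlip-transfer uρ uσ j 2≤j (<-length pρ j∈I) (<-length p j∈I) spike-ρ spike-σ (sym plus) (sym minus))
        where
        uσ : Unique σ
        uσ = IsPerm⇒Unique p
        bounds : All (λ b → suc j < b × b ≤ length σ) js
        bounds = All.zipWith
          (λ (j<b , b-bounds) → j<b , ≤-trans (proj₂ b-bounds) (≤-trans (m∸n≤m n 1) (≤-reflexive (sym (IsPerm⇒length p)))))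
                   (j<js , All-resp-⊆ (∷ˡ⁻ j∷js⊆I) I-bounds)
        tests : ΨJ js σ ↭ σ × plusTest j (ΨJ js σ) ≡ plusTest j σ × minusTest j (ΨJ js σ) ≡ minusTest j σ
        tests = ΨJ-↭-tests uσ j 2≤j js bounds
        plus : plusTest j (ΨJ js σ) ≡ plusTest j σ
        plus = proj₁ (proj₂ tests)
        minus : minusTest j (ΨJ js σ) ≡ minusTest j σ
        minus = proj₂ (proj₂ tests)
        dρ : Dᵖ K (ΨJ js σ)
        dρ = ih-maps σ dσ as
        pρ : IsPerm n (ΨJ js σ)
        pρ = proj₁ dρ
        uρ : Unique (ΨJ js σ)
        uρ = IsPerm⇒Unique pρ
        spike-σ : SpikeAt σ j
        spike-σ = Dᵖ-spike I-strict j∈I 2≤j dσ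
        spike-ρ : SpikeAt (ΨJ js σ) j
        spike-ρ = spike-K dρ

    maps-into : MapsInto (j ∷ js)
    maps-into σ dσ (af ∷ as) =
      ↭-trans (Ψ-↭ uρ j (<⇒≤ (<-length pρ j∈I))) pρ ,
      λ k → trans (Des-Ψ uρ j 2≤j (<-length pρ j∈I) (spike-K dρ) (Equivalence.to (AdmitsFlip-ΨJ dσ as) af) k)
              (trans (cong (toggleBelow j k) (proj₂ dρ k)) (sym (Sᵖ-∖-∷ {js = js} I-strict j∈I j∉js k)))
      where
      dρ : Dᵖ (I ∖ js) (ΨJ js σ)
      dρ = ih-maps σ dσ as
      pρ : IsPerm n (ΨJ js σ)
      pρ = proj₁ dρ
      uρ : Unique (ΨJ js σ)
      uρ = IsPerm⇒Unique pρ

    injective : InjectiveOn (j ∷ js)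
    injective σ τ dσ (_ ∷ as) dτ (_ ∷ bs) e = ih-injective σ τ dσ as dτ bs
      (Ψ-injective (IsPerm⇒Unique (proj₁ dρ)) (IsPerm⇒Unique (proj₁ dρ′)) j 2≤j
        (<-length (proj₁ dρ) j∈I) (<-length (proj₁ dρ′) j∈I) (spike-K dρ) (spike-K dρ′) e)
      where
      dρ : Dᵖ (I ∖ js) (ΨJ js σ)
      dρ = ih-maps σ dσ as
      dρ′ : Dᵖ (I ∖ js) (ΨJ js τ)
      dρ′ = ih-maps τ dτ bs

    surjective : SurjectiveOnto (j ∷ js)
    surjective τ (pτ , dτ) with Ψ-surjective (IsPerm⇒Unique pτ) j 2≤j (<-length pτ j∈I) no-spike
      where
      no-spike : Des τ (j ∸ 1) ≡ Des τ j
      no-spike = trans (dτ (j ∸ 1)) (trans (Sᵖ-no-spike (∉-∖-∷ I j js) 2≤j) (sym (dτ j)))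
    ... | ρ , ρ↭τ , toggled , af , Ψρ≡τ
      with ih-surjective ρ (↭-trans ρ↭τ pτ ,
             λ k → trans (toggled k) (trans (cong (toggleBelow j k) (dτ k)) (sym (Sᵖ-∖ {js = js} I-strict j∈I j∉js k))))
    ...   | σ , dσ , as , refl = σ , dσ , Equivalence.from (AdmitsFlip-ΨJ dσ as) af ∷ as , Ψρ≡τ

  ΨJ-bijective : ∀ J → J ⊆ I → AllPairs (λ a b → suc a < b) J → Bijective J
  ΨJ-bijective [] _ _ = Bijective-[]
  ΨJ-bijective (j ∷ js) j∷js⊆I (j<js ∷ js-admissible) =
    Step.maps-into j js j∷js⊆I j<js ih , Step.injective j js j∷js⊆I j<js ih , Step.surjective j js j∷js⊆I j<js ih
    where
    ih : Bijective js
    ih = ΨJ-bijective js (∷ˡ⁻ j∷js⊆I) js-admissible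

  InD⇔Dᵖ : ∀ {K σ} → AllPairs _<_ K → All (2 ≤_) K → InD (S_ K) n σ ⇔ Dᵖ K σ
  InD⇔Dᵖ K-strict 2≤K = mk⇔ (λ (p , d) → p , λ k → trans (d k) (S≡Sᵖ K-strict 2≤K k))
                            (λ (p , d) → p , λ k → trans (d k) (sym (S≡Sᵖ K-strict 2≤K k)))

Admissible⇒AllPairs : ∀ {I} → Admissible I → AllPairs (λ a b → suc a < b) I
Admissible⇒AllPairs = Linked.Linked⇒AllPairs (λ a+1<b b+1<c → <-trans a+1<b (<-trans (n<1+n _) b+1<c))

mainTheorem5 : (n : ℕ) (I J : List ℕ) →
    Admissible I → All (λ i → 2 ≤ i × i ≤ n ∸ 1) I → J ⊆ I →
    ((σ : List ℕ) → Dom n I J σ → InD (S_ (I ∖ J)) n (ΨJ J σ))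
    × ((σ τ : List ℕ) → Dom n I J σ → Dom n I J τ → ΨJ J σ ≡ ΨJ J τ → σ ≡ τ)
    × ((τ : List ℕ) → InD (S_ (I ∖ J)) n τ → ∃ λ σ → Dom n I J σ × ΨJ J σ ≡ τ)
    × ((m : ℕ) (k : ℤ) (σ : List ℕ) → maxL I ≤ m → Dom n I J σ →
         (WindowIs m k σ ⇔ WindowIs m k (ΨJ J σ)))
mainTheorem5 n I J I-admissible I-bounds J⊆I =
  (λ σ (d , as) → Equivalence.from I∖J-descents (maps-into σ (Equivalence.to I-descents d) as)) ,
  (λ σ τ (d , as) (d′ , bs) → injective σ τ (Equivalence.to I-descents d) as (Equivalence.to I-descents d′) bs) ,
  (λ τ d → let σ , dσ , as , e = surjective τ (Equivalence.to I∖J-descents d)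
           in σ , (Equivalence.from I-descents dσ , as) , e) ,
  λ m k σ maxI≤m ((p , _) , _) →
    let prefix↭ = proj₂ (take-ΨJ-↭ (IsPerm⇒Unique p) m J (All.tabulate (bounds maxI≤m p)))
    in mk⇔ (WindowIs-resp-↭ m k (↭-sym prefix↭)) (WindowIs-resp-↭ m k prefix↭)
  where
  I-admissible′ : AllPairs (λ a b → suc a < b) I
  I-admissible′ = Admissible⇒AllPairs I-admissible
  open Bijection n I I-admissible′ I-bounds
  2≤I : All (2 ≤_) I
  2≤I = All.map proj₁ I-bounds
  I-descents : ∀ {σ} → InD (S_ I) n σ ⇔ Dᵖ I σ
  I-descents = InD⇔Dᵖ I-strict 2≤I
  I∖J-descents : ∀ {σ} → InD (S_ (I ∖ J)) n σ ⇔ Dᵖ (I ∖ J) σ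
  I∖J-descents = InD⇔Dᵖ (AllPairs-∖ J I-strict) (All-∖ J 2≤I)
  bijective : Bijective J
  bijective = ΨJ-bijective J J⊆I (AllPairs-resp-⊆ J⊆I I-admissible′)
  maps-into : MapsInto J
  maps-into = proj₁ bijective
  injective : InjectiveOn J
  injective = proj₁ (proj₂ bijective)
  surjective : SurjectiveOnto J
  surjective = proj₂ (proj₂ bijective)
  bounds : ∀ {m σ} → maxL I ≤ m → IsPerm n σ → ∀ {j} → j ∈ J → j ≤ m × j ≤ length σ
  bounds maxI≤m p j∈J = ≤-trans (≤maxL (Any-resp-⊆ J⊆I j∈J)) maxI≤m ,
    ≤-trans (proj₂ (All.lookup I-bounds (Any-resp-⊆ J⊆I j∈J))) (≤-trans (m∸n≤m n 1) (≤-reflexive (sym (IsPerm⇒length p))))
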